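{- For every integer $n\ge 1$ and every single color $x\in\{r,b,y,g,o,s\}$, \[F(J(T_n(\{x\})),q)=\prod_{j=1}^{n} j!_q=\prod_{1\le i\le j\le k\le n-1}\frac{[i+1]_q}{[i]_q}.\]
   Context: For an integer $n\ge1$, let $T_n$ be the set of triples $(c_1,c_2,c_3)$ of nonnegative integers with $c_1+c_2+c_3\le n-2$. Six colors are associated to vectors: red $r=(1,0,0)$, green $g=(0,1,0)$, yellow $y=(0,0,1)$, blue $b=(-1,1,0)$, orange $o=(-1,0,1)$, silver $s=(0,1,-1)$. For $S\subseteq\{r,b,g,o,y,s\}$, $T_n(S)$ is the poset on $T_n$ whose order relation is the reflexive–transitive closure of the relations $u<u+v$ for all $u,u+v\in T_n$ and $v$ the vector of a color in $S$. $J(P)$ denotes the set of order ideals of a poset $P$ and $F(J(P),q)=\sum_{I\in J(P)}q^{|I|}$. Also $[m]_q=1+q+\dots+q^{m-1}$ and $m!_q=[1]_q[2]_q\cdots[m]_q$. -}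

module Defs where

open import Data.Nat as ℕ using (ℕ; zero; suc; _≤?_; _∸_)
open import Data.Integer as ℤ using (ℤ; +_; -[1+_])
open import Data.Product using (_×_; _,_; Σ; ∃)
open import Data.List using (List; []; _∷_; upTo; map; concatMap; filter; length; foldr)
open import Data.Nat.ListAction using (sum)
open import Data.List.Relation.Unary.All using (All)
open import Data.List.Relation.Unary.Unique.Propositional using (Unique)
import Data.List.Membership.Propositional as LM
open import Data.List.Membership.Propositional using () renaming (_∈_ to _∈L_)
open import Data.Fin using (Fin)
open import Data.Fin.Subset using (Subset; _∈_; ∣_∣)
open import Data.List.Base using (lookup)
open import Relation.Binary.PropositionalEquality using (_≡_)
import Relation.Nullary
open import Relation.Binary.Construct.Closure.ReflexiveTransitive using (Star)

Vec3 : Set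
Vec3 = ℤ × ℤ × ℤ

_+³_ : Vec3 → Vec3 → Vec3
(a , b , c) +³ (a' , b' , c') = (a ℤ.+ a' , b ℤ.+ b' , c ℤ.+ c')

data Color : Set where
  r g y b o s : Color

vec : Color → Vec3
vec r = (+ 1 , + 0 , + 0)
vec g = (+ 0 , + 1 , + 0)
vec y = (+ 0 , + 0 , + 1)
vec b = (-[1+ 0 ] , + 1 , + 0)
vec o = (-[1+ 0 ] , + 0 , + 1)
vec s = (+ 0 , + 1 , -[1+ 0 ])

-- The ground set T_n : triples (c₁,c₂,c₃) of naturals with
-- c₁ + c₂ + c₃ ≤ n - 2 (i.e. c₁+c₂+c₃+2 ≤ n; empty for n = 1),
-- enumerated without repetition as a list.

triples : ℕ → List (ℕ × ℕ × ℕ)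
triples n = concatMap (λ a → concatMap (λ c₂ → map (λ c₃ → (a , c₂ , c₃)) (upTo n)) (upTo n)) (upTo n)

Tlist : ℕ → List (ℕ × ℕ × ℕ)
Tlist n = filter (λ { (a , c₂ , c₃) → (a ℕ.+ c₂ ℕ.+ c₃ ℕ.+ 2) ≤? n }) (triples n)

size : ℕ → ℕ
size n = length (Tlist n)

elt : (n : ℕ) → Fin (size n) → Vec3
elt n i with lookup (Tlist n) i
... | (a , c₂ , c₃) = (+ a , + c₂ , + c₃)

Cover : (n : ℕ) → List Color → Fin (size n) → Fin (size n) → Set
Cover n S i j = Σ Color (λ x → (x ∈L S) × (elt n j ≡ (elt n i +³ vec x)))

Leq : (n : ℕ) → List Color → Fin (size n) → Fin (size n) → Set
Leq n S = Star (Cover n S)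

IsOrderIdeal : (n : ℕ) → List Color → Subset (size n) → Set
IsOrderIdeal n S I = ∀ i j → Leq n S i j → j ∈ I → i ∈ I

CountIs : {m : ℕ} → (Subset m → Set) → ℕ → Set
CountIs {m} P c = Σ (List (Subset m)) (λ L →
  Unique L × All P L × (∀ I → P I → I ∈L L) × length L ≡ c)

-- Polynomials in q with natural coefficients, as coefficient sequences.

Poly : Set
Poly = ℕ → ℕ

_≈P_ : Poly → Poly → Set
f ≈P h = ∀ k → f k ≡ h k

oneP : Poly
oneP zero = 1
oneP (suc k) = 0

_*P_ : Poly → Poly → Poly
(f *P h) k = sum (map (λ i → f i ℕ.* h (k ∸ i)) (upTo (suc k)))

prodP : List Poly → Poly
prodP = foldr _*P_ oneP

-- [m]_q = 1 + q + ... + q^(m-1)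
qint : ℕ → Poly
qint m k with suc k ≤? m
... | Relation.Nullary.yes _ = 1
... | Relation.Nullary.no _ = 0

oneTo : ℕ → List ℕ
oneTo m = map suc (upTo m)

qfact : ℕ → Poly
qfact m = prodP (map qint (oneTo m))

IsIdealGenFun : (n : ℕ) → List Color → Poly → Set
IsIdealGenFun n S f =
  ∀ k → CountIs (λ (I : Subset (size n)) → IsOrderIdeal n S I × ∣ I ∣ ≡ k) (f k)

prodFact : ℕ → Poly
prodFact n = prodP (map qfact (oneTo n))

ijkTriples : ℕ → List (ℕ × ℕ × ℕ)
ijkTriples m = concatMap (λ k → concatMap (λ j → map (λ i → (i , j , k)) (oneTo j)) (oneTo k)) (oneTo m)

denomProd : ℕ → Poly
denomProd m = prodP (map (λ { (i , _ , _) → qint i }) (ijkTriples m))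

numerProd : ℕ → Poly
numerProd m = prodP (map (λ { (i , _ , _) → qint (suc i) }) (ijkTriples m))

-- For a single colour x, every point of T_n has at most one upper and one lower cover in
-- T_n({x}), so the poset is a disjoint union of chains.  They can be indexed by 0 ≤ I ≤ J < n,
-- the chain (J, I) having I elements; e.g. for x = r it consists of the points (t, J − I, n − 1 − J)
-- with t < I.  Order ideals of a disjoint union of closed pieces are tuples of order ideals of the
-- pieces, so generating functions multiply, and a chain with I elements contributes [I + 1]_q.
-- Hence F(J(T_n({x})), q) = ∏_{J<n} ∏_{I≤J} [I + 1]_q = ∏_{j=1}^{n} j!_q.  The second identity
-- regroups ∏_{1≤i≤j≤k≤n−1} [i + 1]_q / [i]_q as ∏_{k} ∏_{j≤k} (j + 1)!_q / j!_q = ∏_{k} (k + 1)!_q.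

module Submission where

open import Defs hiding (r; g; y; b; o; s)
open import Data.Nat using (ℕ; suc; _≤_; _∸_)
open import Data.Product using (_×_; _,_)
open import Data.List using ([_])

module Polynomial where

  open import Data.Nat using (ℕ; zero; suc; _+_; _*_; _∸_; _<_; z≤n; s≤s)
  open import Data.Nat.Properties
  open import Data.Nat.ListAction using (sum)
  open import Data.Nat.Tactic.RingSolver using (solve-∀)
  open import Data.List using (List; []; _∷_; _++_; map; concat; concatMap; applyUpTo)
  open import Data.List.Properties using (map-upTo; map-∘)
  open import Relation.Binary.PropositionalEquality
  open import Relation.Binary.Bundles using (Setoid)
  import Relation.Binary.Reasoning.Setoid as SetoidReasoning
  open import Function using (_∘_)

  sumBelow : ℕ → (ℕ → ℕ) → ℕ
  sumBelow n f = sum (applyUpTo f n)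

  sumBelow-cong : ∀ n {f g} → (∀ i → i < n → f i ≡ g i) → sumBelow n f ≡ sumBelow n g
  sumBelow-cong zero     eq = refl
  sumBelow-cong (suc n) eq =
    cong₂ _+_ (eq 0 (s≤s z≤n)) (sumBelow-cong n (λ i i<n → eq (suc i) (s≤s i<n)))

  sumBelow-cong′ : ∀ n {f g} → (∀ i → f i ≡ g i) → sumBelow n f ≡ sumBelow n g
  sumBelow-cong′ n eq = sumBelow-cong n (λ i _ → eq i)

  sumBelow-zero : ∀ n → sumBelow n (λ _ → 0) ≡ 0
  sumBelow-zero zero    = refl
  sumBelow-zero (suc n) = sumBelow-zero n

  sumBelow-+ : ∀ n f g → sumBelow n (λ i → f i + g i) ≡ sumBelow n f + sumBelow n g
  sumBelow-+ zero    f g = refl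
  sumBelow-+ (suc n) f g = begin
    f 0 + g 0 + sumBelow n (λ i → f (suc i) + g (suc i))
      ≡⟨ cong (f 0 + g 0 +_) (sumBelow-+ n (f ∘ suc) (g ∘ suc)) ⟩
    f 0 + g 0 + (sumBelow n (f ∘ suc) + sumBelow n (g ∘ suc))
      ≡⟨ interchange (f 0) (g 0) _ _ ⟩
    f 0 + sumBelow n (f ∘ suc) + (g 0 + sumBelow n (g ∘ suc)) ∎
    where
    open ≡-Reasoning
    interchange : ∀ a b c d → a + b + (c + d) ≡ a + c + (b + d)
    interchange = solve-∀

  *-sumBelow : ∀ n c f → c * sumBelow n f ≡ sumBelow n (λ i → c * f i)
  *-sumBelow zero    c f = *-zeroʳ c
  *-sumBelow (suc n) c f =
    trans (*-distribˡ-+ c (f 0) _) (cong (c * f 0 +_) (*-sumBelow n c (f ∘ suc)))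

  sumBelow-* : ∀ n c f → sumBelow n f * c ≡ sumBelow n (λ i → f i * c)
  sumBelow-* n c f =
    trans (*-comm (sumBelow n f) c) (trans (*-sumBelow n c f) (sumBelow-cong′ n (λ i → *-comm c (f i))))

  sumBelow-suc : ∀ n f → sumBelow (suc n) f ≡ sumBelow n f + f n
  sumBelow-suc zero    f = +-comm (f 0) 0
  sumBelow-suc (suc n) f =
    trans (cong (f 0 +_) (sumBelow-suc n (f ∘ suc))) (sym (+-assoc (f 0) _ _))

  sumBelow-reverse : ∀ k f → sumBelow (suc k) f ≡ sumBelow (suc k) (λ i → f (k ∸ i))
  sumBelow-reverse zero    f = refl
  sumBelow-reverse (suc k) f = begin
    f 0 + sumBelow (suc k) (f ∘ suc)
      ≡⟨ cong (f 0 +_) (sumBelow-reverse k (f ∘ suc)) ⟩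
    f 0 + sumBelow (suc k) (λ i → f (suc (k ∸ i)))
      ≡⟨ cong (f 0 +_) (sumBelow-cong (suc k) (λ i i≤k → cong f (sym (+-∸-assoc 1 (≤-pred i≤k))))) ⟩
    f 0 + sumBelow (suc k) (λ i → f (suc k ∸ i))
      ≡⟨ +-comm (f 0) _ ⟩
    sumBelow (suc k) (λ i → f (suc k ∸ i)) + f 0
      ≡⟨ cong (λ j → sumBelow (suc k) (λ i → f (suc k ∸ i)) + f j) (n∸n≡0 k) ⟨
    sumBelow (suc k) (λ i → f (suc k ∸ i)) + f (suc k ∸ suc k)
      ≡⟨ sym (sumBelow-suc (suc k) (λ i → f (suc k ∸ i))) ⟩
    sumBelow (suc (suc k)) (λ i → f (suc k ∸ i)) ∎
    where open ≡-Reasoning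

  sumBelow-triangle : ∀ k (F : ℕ → ℕ → ℕ) →
    sumBelow (suc k) (λ i → sumBelow (suc i) (λ a → F a i)) ≡
    sumBelow (suc k) (λ a → sumBelow (suc (k ∸ a)) (λ b → F a (a + b)))
  sumBelow-triangle zero    F = refl
  sumBelow-triangle (suc k) F = begin
    (F 0 0 + 0) + sumBelow (suc k) (λ i → F 0 (suc i) + sumBelow (suc i) (λ a → F (suc a) (suc i)))
      ≡⟨ cong (F 0 0 + 0 +_)
           (sumBelow-+ (suc k) (λ i → F 0 (suc i)) (λ i → sumBelow (suc i) (λ a → F (suc a) (suc i)))) ⟩
    (F 0 0 + 0) + (firstRow + sumBelow (suc k) (λ i → sumBelow (suc i) (λ a → F (suc a) (suc i))))
      ≡⟨ cong (λ z → F 0 0 + 0 + (firstRow + z)) (sumBelow-triangle k (λ a i → F (suc a) (suc i))) ⟩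
    (F 0 0 + 0) + (firstRow + otherRows)
      ≡⟨ regroup (F 0 0) firstRow otherRows ⟩
    F 0 0 + firstRow + otherRows ∎
    where
    open ≡-Reasoning
    firstRow  = sumBelow (suc k) (λ b → F 0 (suc b))
    otherRows = sumBelow (suc k) (λ a → sumBelow (suc (k ∸ a)) (λ b → F (suc a) (suc (a + b))))
    regroup : ∀ a b c → a + 0 + (b + c) ≡ a + b + c
    regroup = solve-∀

  *P-unfold : ∀ f h k → (f *P h) k ≡ sumBelow (suc k) (λ i → f i * h (k ∸ i))
  *P-unfold f h k = cong sum (map-upTo (λ i → f i * h (k ∸ i)) (suc k))

  ≈P-refl : ∀ {f} → f ≈P f
  ≈P-refl k = refl

  ≈P-reflexive : ∀ {f h} → f ≡ h → f ≈P h
  ≈P-reflexive refl = ≈P-refl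

  ≈P-sym : ∀ {f h} → f ≈P h → h ≈P f
  ≈P-sym eq k = sym (eq k)

  ≈P-trans : ∀ {f g h} → f ≈P g → g ≈P h → f ≈P h
  ≈P-trans eq eq′ k = trans (eq k) (eq′ k)

  ≈P-setoid : Setoid _ _
  ≈P-setoid = record
    { Carrier = Poly ; _≈_ = _≈P_
    ; isEquivalence = record { refl = ≈P-refl ; sym = ≈P-sym ; trans = ≈P-trans } }

  module ≈P-Reasoning = SetoidReasoning ≈P-setoid

  *P-cong : ∀ {f f′ h h′} → f ≈P f′ → h ≈P h′ → (f *P h) ≈P (f′ *P h′)
  *P-cong {f} {f′} {h} {h′} f≈ h≈ k = begin
    (f *P h) k                                ≡⟨ *P-unfold f h k ⟩
    sumBelow (suc k) (λ i → f i * h (k ∸ i))   ≡⟨ sumBelow-cong′ (suc k) (λ i → cong₂ _*_ (f≈ i) (h≈ (k ∸ i))) ⟩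
    sumBelow (suc k) (λ i → f′ i * h′ (k ∸ i)) ≡⟨ *P-unfold f′ h′ k ⟨
    (f′ *P h′) k                              ∎
    where open ≡-Reasoning

  *P-comm : ∀ f h → (f *P h) ≈P (h *P f)
  *P-comm f h k = begin
    (f *P h) k                                      ≡⟨ *P-unfold f h k ⟩
    sumBelow (suc k) (λ i → f i * h (k ∸ i))         ≡⟨ sumBelow-reverse k (λ i → f i * h (k ∸ i)) ⟩
    sumBelow (suc k) (λ i → f (k ∸ i) * h (k ∸ (k ∸ i)))
      ≡⟨ sumBelow-cong (suc k) (λ i i≤k →
           trans (cong (λ j → f (k ∸ i) * h j) (m∸[m∸n]≡n (≤-pred i≤k))) (*-comm (f (k ∸ i)) (h i))) ⟩
    sumBelow (suc k) (λ i → h i * f (k ∸ i))         ≡⟨ *P-unfold h f k ⟨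
    (h *P f) k                                      ∎
    where open ≡-Reasoning

  *P-assoc : ∀ f g h → ((f *P g) *P h) ≈P (f *P (g *P h))
  *P-assoc f g h k = begin
    ((f *P g) *P h) k
      ≡⟨ *P-unfold (f *P g) h k ⟩
    sumBelow (suc k) (λ i → (f *P g) i * h (k ∸ i))
      ≡⟨ sumBelow-cong′ (suc k) (λ i →
           trans (cong (_* h (k ∸ i)) (*P-unfold f g i)) (sumBelow-* (suc i) (h (k ∸ i)) (λ a → f a * g (i ∸ a)))) ⟩
    sumBelow (suc k) (λ i → sumBelow (suc i) (λ a → f a * g (i ∸ a) * h (k ∸ i)))
      ≡⟨ sumBelow-triangle k (λ a i → f a * g (i ∸ a) * h (k ∸ i)) ⟩
    sumBelow (suc k) (λ a → sumBelow (suc (k ∸ a)) (λ b → f a * g (a + b ∸ a) * h (k ∸ (a + b))))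
      ≡⟨ sumBelow-cong′ (suc k) (λ a → sumBelow-cong′ (suc (k ∸ a)) (λ b →
           trans (cong₂ (λ u v → f a * g u * h v) (m+n∸m≡n a b) (sym (∸-+-assoc k a b)))
                 (*-assoc (f a) (g b) _))) ⟩
    sumBelow (suc k) (λ a → sumBelow (suc (k ∸ a)) (λ b → f a * (g b * h (k ∸ a ∸ b))))
      ≡⟨ sumBelow-cong′ (suc k) (λ a →
           trans (sym (*-sumBelow (suc (k ∸ a)) (f a) (λ b → g b * h (k ∸ a ∸ b))))
                 (cong (f a *_) (sym (*P-unfold g h (k ∸ a))))) ⟩
    sumBelow (suc k) (λ a → f a * (g *P h) (k ∸ a))
      ≡⟨ *P-unfold f (g *P h) k ⟨
    (f *P (g *P h)) k ∎
    where open ≡-Reasoning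

  *P-identityˡ : ∀ f → (oneP *P f) ≈P f
  *P-identityˡ f k = begin
    (oneP *P f) k                             ≡⟨ *P-unfold oneP f k ⟩
    f k + 0 + sumBelow k (λ i → 0 * f (k ∸ suc i)) ≡⟨ cong (f k + 0 +_) (sumBelow-zero k) ⟩
    f k + 0 + 0                               ≡⟨ trans (+-identityʳ _) (+-identityʳ _) ⟩
    f k                                       ∎
    where open ≡-Reasoning

  *P-identityʳ : ∀ f → (f *P oneP) ≈P f
  *P-identityʳ f = ≈P-trans (*P-comm f oneP) (*P-identityˡ f)

  *P-interchange : ∀ a b c d → ((a *P b) *P (c *P d)) ≈P ((a *P c) *P (b *P d))
  *P-interchange a b c d = begin
    (a *P b) *P (c *P d) ≈⟨ *P-assoc a b (c *P d) ⟩
    a *P (b *P (c *P d)) ≈⟨ *P-cong (≈P-refl {a}) (*P-assoc b c d) ⟨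
    a *P ((b *P c) *P d) ≈⟨ *P-cong (≈P-refl {a}) (*P-cong (*P-comm b c) (≈P-refl {d})) ⟩
    a *P ((c *P b) *P d) ≈⟨ *P-cong (≈P-refl {a}) (*P-assoc c b d) ⟩
    a *P (c *P (b *P d)) ≈⟨ *P-assoc a c (b *P d) ⟨
    (a *P c) *P (b *P d) ∎
    where open ≈P-Reasoning

  prodP-++ : ∀ fs hs → prodP (fs ++ hs) ≈P (prodP fs *P prodP hs)
  prodP-++ []       hs = ≈P-sym (*P-identityˡ (prodP hs))
  prodP-++ (f ∷ fs) hs =
    ≈P-trans (*P-cong (≈P-refl {f}) (prodP-++ fs hs)) (≈P-sym (*P-assoc f (prodP fs) (prodP hs)))

  prodP-concat : ∀ fss → prodP (concat fss) ≈P prodP (map prodP fss)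
  prodP-concat []         = ≈P-refl
  prodP-concat (fs ∷ fss) =
    ≈P-trans (prodP-++ fs (concat fss)) (*P-cong (≈P-refl {prodP fs}) (prodP-concat fss))

  prodP-concatMap : ∀ {A : Set} (F : A → List Poly) xs →
                    prodP (concatMap F xs) ≈P prodP (map (prodP ∘ F) xs)
  prodP-concatMap F xs = ≈P-trans (prodP-concat (map F xs)) (≈P-reflexive (cong prodP (sym (map-∘ xs))))

  prodP-cong : ∀ {A : Set} {f h : A → Poly} → (∀ a → f a ≈P h a) → ∀ xs →
               prodP (map f xs) ≈P prodP (map h xs)
  prodP-cong eq []       = ≈P-refl
  prodP-cong eq (x ∷ xs) = *P-cong (eq x) (prodP-cong eq xs)

  prodP-map-*P : ∀ {A : Set} (f h : A → Poly) xs →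
                 prodP (map (λ a → f a *P h a) xs) ≈P (prodP (map f xs) *P prodP (map h xs))
  prodP-map-*P f h []       = ≈P-sym (*P-identityˡ oneP)
  prodP-map-*P f h (x ∷ xs) =
    ≈P-trans (*P-cong (≈P-refl {f x *P h x}) (prodP-map-*P f h xs)) (*P-interchange (f x) (h x) _ _)

module QFactorial where

  open Polynomial
  open import Data.Nat using (ℕ; zero; suc)
  open import Data.Product using (_×_; _,_)
  open import Data.List using (_∷_; _++_; [_]; map; concatMap; upTo; applyUpTo)
  open import Data.List.Properties using (map-∘; map-concatMap; map-applyUpTo; map-upTo; map-++; upTo-∷ʳ)
  open import Relation.Binary.PropositionalEquality using (_≡_; refl; cong; sym; module ≡-Reasoning)
  open import Function using (_∘_)

  map-oneTo-suc : ∀ {A : Set} (F : ℕ → A) m → map F (oneTo (suc m)) ≡ F 1 ∷ map (F ∘ suc) (oneTo m)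
  map-oneTo-suc F m = cong (F 1 ∷_) (begin
    map F (map suc (applyUpTo suc m))   ≡⟨ map-∘ (applyUpTo suc m) ⟨
    map (F ∘ suc) (applyUpTo suc m)     ≡⟨ map-applyUpTo suc (F ∘ suc) m ⟩
    applyUpTo (F ∘ suc ∘ suc) m         ≡⟨ map-upTo (F ∘ suc ∘ suc) m ⟨
    map (F ∘ suc ∘ suc) (upTo m)        ≡⟨ map-∘ (upTo m) ⟩
    map (F ∘ suc) (map suc (upTo m))    ∎)
    where open ≡-Reasoning

  map-oneTo-suc-last : ∀ {A : Set} (F : ℕ → A) m → map F (oneTo (suc m)) ≡ map F (oneTo m) ++ [ F (suc m) ]
  map-oneTo-suc-last F m = begin
    map F (map suc (upTo (suc m)))           ≡⟨ cong (map F ∘ map suc) (upTo-∷ʳ m) ⟨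
    map F (map suc (upTo m ++ [ m ]))        ≡⟨ cong (map F) (map-++ suc (upTo m) [ m ]) ⟩
    map F (oneTo m ++ [ suc m ])             ≡⟨ map-++ F (oneTo m) [ suc m ] ⟩
    map F (oneTo m) ++ [ F (suc m) ]         ∎
    where open ≡-Reasoning

  qint-1 : qint 1 ≈P oneP
  qint-1 zero    = refl
  qint-1 (suc k) = refl

  prodP-oneTo-suc : ∀ (F : ℕ → Poly) m → F 1 ≈P oneP →
                    prodP (map F (oneTo (suc m))) ≈P prodP (map (F ∘ suc) (oneTo m))
  prodP-oneTo-suc F m F1≈1 = begin
    prodP (map F (oneTo (suc m)))                ≡⟨ cong prodP (map-oneTo-suc F m) ⟩
    F 1 *P prodP (map (F ∘ suc) (oneTo m))       ≈⟨ *P-cong F1≈1 ≈P-refl ⟩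
    oneP *P prodP (map (F ∘ suc) (oneTo m))      ≈⟨ *P-identityˡ _ ⟩
    prodP (map (F ∘ suc) (oneTo m))              ∎
    where open ≈P-Reasoning

  qfact-suc : ∀ j → qfact (suc j) ≈P (qfact j *P qint (suc j))
  qfact-suc j = begin
    qfact (suc j)                                ≡⟨ cong prodP (map-oneTo-suc-last qint j) ⟩
    prodP (map qint (oneTo j) ++ [ qint (suc j) ]) ≈⟨ prodP-++ (map qint (oneTo j)) [ qint (suc j) ] ⟩
    qfact j *P (qint (suc j) *P oneP)            ≈⟨ *P-cong (≈P-refl {qfact j}) (*P-identityʳ _) ⟩
    qfact j *P qint (suc j)                      ∎
    where open ≈P-Reasoning

  qfact-suc-shifted : ∀ j → qfact (suc j) ≈P prodP (map (qint ∘ suc) (oneTo j))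
  qfact-suc-shifted j = prodP-oneTo-suc qint j qint-1

  qfact-1 : qfact 1 ≈P oneP
  qfact-1 = ≈P-trans (*P-identityʳ (qint 1)) qint-1

  prodP-ijkTriples : ∀ (G : ℕ × ℕ × ℕ → Poly) m → prodP (map G (ijkTriples m)) ≈P
    prodP (map (λ k → prodP (map (λ j → prodP (map (λ i → G (i , j , k)) (oneTo j))) (oneTo k))) (oneTo m))
  prodP-ijkTriples G m = begin
    prodP (map G (ijkTriples m))
      ≡⟨ cong prodP (map-concatMap G _ (oneTo m)) ⟩
    prodP (concatMap (λ k → map G (concatMap (λ j → map (λ i → (i , j , k)) (oneTo j)) (oneTo k))) (oneTo m))
      ≈⟨ prodP-concatMap _ (oneTo m) ⟩
    prodP (map (λ k → prodP (map G (concatMap (λ j → map (λ i → (i , j , k)) (oneTo j)) (oneTo k)))) (oneTo m))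
      ≈⟨ prodP-cong (λ k → triangle k) (oneTo m) ⟩
    prodP (map (λ k → prodP (map (λ j → prodP (map (λ i → G (i , j , k)) (oneTo j))) (oneTo k))) (oneTo m))
      ∎
    where
    open ≈P-Reasoning
    triangle : ∀ k → prodP (map G (concatMap (λ j → map (λ i → (i , j , k)) (oneTo j)) (oneTo k))) ≈P
                     prodP (map (λ j → prodP (map (λ i → G (i , j , k)) (oneTo j))) (oneTo k))
    triangle k = begin
      prodP (map G (concatMap (λ j → map (λ i → (i , j , k)) (oneTo j)) (oneTo k)))
        ≡⟨ cong prodP (map-concatMap G _ (oneTo k)) ⟩
      prodP (concatMap (λ j → map G (map (λ i → (i , j , k)) (oneTo j))) (oneTo k))
        ≈⟨ prodP-concatMap _ (oneTo k) ⟩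
      prodP (map (λ j → prodP (map G (map (λ i → (i , j , k)) (oneTo j)))) (oneTo k))
        ≈⟨ prodP-cong (λ j → ≈P-reflexive (cong prodP (sym (map-∘ (oneTo j))))) (oneTo k) ⟩
      prodP (map (λ j → prodP (map (λ i → G (i , j , k)) (oneTo j))) (oneTo k))
        ∎

  prodFact-*P-denomProd : ∀ m → (prodFact (suc m) *P denomProd m) ≈P numerProd m
  prodFact-*P-denomProd m = ≈P-sym (begin
    numerProd m
      ≈⟨ prodP-ijkTriples (λ { (i , _ , _) → qint (suc i) }) m ⟩
    prodP (map (λ k → prodP (map (λ j → prodP (map (qint ∘ suc) (oneTo j))) (oneTo k))) (oneTo m))
      ≈⟨ prodP-cong (λ k → prodP-cong (λ j → ≈P-trans (≈P-sym (qfact-suc-shifted j)) (qfact-suc j))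
                                       (oneTo k)) (oneTo m) ⟩
    prodP (map (λ k → prodP (map (λ j → qfact j *P qint (suc j)) (oneTo k))) (oneTo m))
      ≈⟨ prodP-cong (λ k → prodP-map-*P qfact (qint ∘ suc) (oneTo k)) (oneTo m) ⟩
    prodP (map (λ k → prodP (map qfact (oneTo k)) *P prodP (map (qint ∘ suc) (oneTo k))) (oneTo m))
      ≈⟨ prodP-cong (λ k → *P-cong (≈P-refl {prodP (map qfact (oneTo k))}) (qfact-suc-shifted k)) (oneTo m) ⟨
    prodP (map (λ k → prodP (map qfact (oneTo k)) *P qfact (suc k) ) (oneTo m))
      ≈⟨ prodP-map-*P (λ k → prodP (map qfact (oneTo k))) (qfact ∘ suc) (oneTo m) ⟩
    prodP (map (λ k → prodP (map qfact (oneTo k))) (oneTo m)) *P prodP (map (qfact ∘ suc) (oneTo m))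
      ≈⟨ *P-cong (prodP-ijkTriples (λ { (i , _ , _) → qint i }) m) (prodP-oneTo-suc qfact m qfact-1) ⟨
    denomProd m *P prodFact (suc m)
      ≈⟨ *P-comm (denomProd m) (prodFact (suc m)) ⟩
    prodFact (suc m) *P denomProd m
      ∎)
    where open ≈P-Reasoning

module ListFacts where

  open import Data.Nat using (_+_; _*_)
  open import Data.Nat.ListAction using (sum)
  open import Data.Product using (_×_; _,_; proj₂; ∃-syntax)
  open import Data.Empty using (⊥-elim)
  open import Data.Fin using (zero; suc)
  open import Data.List using (List; []; _∷_; _++_; [_]; map; concatMap; length; lookup)
  open import Data.List.Properties using (length-++)
  open import Data.List.Relation.Unary.All using (All)
  open import Data.List.Relation.Unary.All.Properties using (All¬⇒¬Any; ++⁻)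
  open import Data.List.Relation.Unary.Any using (here; there)
  open import Data.List.Relation.Unary.AllPairs using ([]; _∷_; head; tail)
  open import Data.List.Relation.Unary.Unique.Propositional using (Unique)
  import Data.List.Relation.Unary.Unique.Propositional.Properties as Unique
  open import Data.List.Relation.Binary.Disjoint.Propositional using (Disjoint)
  open import Data.List.Relation.Binary.Subset.Propositional using (_⊆_)
  open import Data.List.Relation.Binary.Permutation.Propositional using (_↭_; ↭-refl; ↭-prep; ↭-trans; ↭-sym; ↭⇒↭ₛ)
  open import Data.List.Relation.Binary.Permutation.Propositional.Properties using (∈-resp-↭; shift)
  open import Data.List.Relation.Binary.Permutation.Setoid.Properties using (Unique-resp-↭)
  open import Data.List.Membership.Propositional using (_∈_; find; lose)
  open import Data.List.Membership.Propositional.Properties using (∈-concatMap⁺; ∈-concatMap⁻; ∈-lookup; ∈-∃++)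
  open import Relation.Binary.PropositionalEquality using (_≡_; _≢_; refl; cong; subst; sym; trans; setoid)
  open import Function using (_∘_)

  private variable
    A B : Set

  ∈-concatMap⁺′ : ∀ (F : A → List B) {xs x y} → x ∈ xs → y ∈ F x → y ∈ concatMap F xs
  ∈-concatMap⁺′ F x∈xs y∈Fx = ∈-concatMap⁺ F (lose x∈xs y∈Fx)

  ∈-concatMap⁻′ : ∀ (F : A → List B) xs {y} → y ∈ concatMap F xs → ∃[ x ] x ∈ xs × y ∈ F x
  ∈-concatMap⁻′ F xs y∈ = find (∈-concatMap⁻ F {xs = xs} y∈)

  Unique-concatMap⁺ : ∀ (F : A → List B) xs → Unique xs → (∀ x → x ∈ xs → Unique (F x)) →
    (∀ x z y → x ∈ xs → z ∈ xs → y ∈ F x → y ∈ F z → x ≡ z) → Unique (concatMap F xs)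
  Unique-concatMap⁺ F []       _                  _      _       = []
  Unique-concatMap⁺ F (x ∷ xs) (x∉xs ∷ unique-xs) unique same-x =
    Unique.++⁺ (unique x (here refl))
      (Unique-concatMap⁺ F xs unique-xs (λ z → unique z ∘ there)
        (λ z w y z∈ w∈ → same-x z w y (there z∈) (there w∈)))
      λ (y∈Fx , y∈rest) →
        let z , z∈xs , y∈Fz = ∈-concatMap⁻′ F xs y∈rest
        in All¬⇒¬Any x∉xs (subst (_∈ xs) (sym (same-x x z _ (here refl) (there z∈xs) y∈Fx y∈Fz)) z∈xs)

  Unique-++⁻ʳ : ∀ (xs : List A) {ys} → Unique (xs ++ ys) → Unique ys
  Unique-++⁻ʳ []       unique        = unique
  Unique-++⁻ʳ (x ∷ xs) (_ ∷ unique) = Unique-++⁻ʳ xs unique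

  Unique-++⇒Disjoint : ∀ (xs : List A) {ys} → Unique (xs ++ ys) → Disjoint xs ys
  Unique-++⇒Disjoint (x ∷ xs) (x∉ ∷ _)      (here refl , v∈ys)  = All¬⇒¬Any (proj₂ (++⁻ xs x∉)) v∈ys
  Unique-++⇒Disjoint (x ∷ xs) (_ ∷ unique) (there v∈xs , v∈ys) = Unique-++⇒Disjoint xs unique (v∈xs , v∈ys)

  length-concatMap : ∀ (F : A → List B) xs → length (concatMap F xs) ≡ sum (map (length ∘ F) xs)
  length-concatMap F []       = refl
  length-concatMap F (x ∷ xs) = trans (length-++ (F x)) (cong (length (F x) +_) (length-concatMap F xs))

  sum-map-const : ∀ (xs : List A) c → sum (map (λ _ → c) xs) ≡ length xs * c
  sum-map-const []       c = refl
  sum-map-const (x ∷ xs) c = cong (c +_) (sum-map-const xs c)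

  lookup-injective : ∀ (xs : List A) → Unique xs → ∀ i j → lookup xs i ≡ lookup xs j → i ≡ j
  lookup-injective (x ∷ xs) _           zero    zero    _  = refl
  lookup-injective (x ∷ xs) (x∉ ∷ _)    zero    (suc j) eq =
    ⊥-elim (All¬⇒¬Any x∉ (subst (_∈ xs) (sym eq) (∈-lookup j)))
  lookup-injective (x ∷ xs) (x∉ ∷ _)    (suc i) zero    eq =
    ⊥-elim (All¬⇒¬Any x∉ (subst (_∈ xs) eq (∈-lookup i)))
  lookup-injective (x ∷ xs) (_ ∷ uniq)  (suc i) (suc j) eq = cong suc (lookup-injective xs uniq i j eq)

  Unique-⊆-⊇⇒↭ : ∀ {xs ys : List A} → Unique xs → Unique ys → xs ⊆ ys → ys ⊆ xs → xs ↭ ys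
  Unique-⊆-⊇⇒↭ {xs = []} {[]}     _ _ _ _ = ↭-refl
  Unique-⊆-⊇⇒↭ {xs = []} {y ∷ ys} _ _ _ ys⊆ with () ← ys⊆ (here refl)
  Unique-⊆-⊇⇒↭ {xs = x ∷ xs} (x∉xs ∷ unique-xs) unique-ys xs⊆ ys⊆
    with ys₁ , ys₂ , refl ← ∈-∃++ (xs⊆ (here refl)) =
    ↭-trans (↭-prep x (Unique-⊆-⊇⇒↭ unique-xs unique-zs xs⊆zs zs⊆xs)) (↭-sym ys↭)
    where
    ys↭ : ys₁ ++ [ x ] ++ ys₂ ↭ x ∷ ys₁ ++ ys₂
    ys↭ = shift x ys₁ ys₂
    unique-x∷zs : Unique (x ∷ ys₁ ++ ys₂)
    unique-x∷zs = Unique-resp-↭ (setoid _) (↭⇒↭ₛ ys↭) unique-ys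
    x∉zs : All (x ≢_) (ys₁ ++ ys₂)
    x∉zs = head unique-x∷zs
    unique-zs : Unique (ys₁ ++ ys₂)
    unique-zs = tail unique-x∷zs
    xs⊆zs : xs ⊆ ys₁ ++ ys₂
    xs⊆zs {z} z∈xs with ∈-resp-↭ ys↭ (xs⊆ (there z∈xs))
    ... | here refl = ⊥-elim (All¬⇒¬Any x∉xs z∈xs)
    ... | there z∈zs = z∈zs
    zs⊆xs : ys₁ ++ ys₂ ⊆ xs
    zs⊆xs z∈zs with ys⊆ (∈-resp-↭ (↭-sym ys↭) (there z∈zs))
    ... | here refl = ⊥-elim (All¬⇒¬Any x∉zs z∈zs)
    ... | there z∈xs = z∈xs

module Counting where

  open import Data.Product using (_,_; proj₁; proj₂)
  open import Data.Fin.Subset using (Subset)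
  open import Data.List using (List; map; length)
  open import Data.List.Relation.Unary.All using (All)
  open import Data.List.Relation.Unary.Unique.Propositional using (Unique)
  open import Data.List.Properties using (length-map)
  import Data.List.Relation.Unary.All as All
  import Data.List.Relation.Unary.All.Properties as All
  import Data.List.Relation.Unary.Unique.Propositional.Properties as Unique
  open import Data.List.Membership.Propositional using (_∈_)
  open import Data.List.Membership.Propositional.Properties using (∈-map⁺)
  open import Relation.Binary.PropositionalEquality using (_≡_; cong; subst; sym; trans)

  module _ {m} {P : Subset m → Set} {c} (count : CountIs P c) where

    listing : List (Subset m)
    listing = proj₁ count

    listing-unique : Unique listing
    listing-unique = proj₁ (proj₂ count)

    listing-sound : All P listing
    listing-sound = proj₁ (proj₂ (proj₂ count))

    listing-complete : ∀ ℓ → P ℓ → ℓ ∈ listing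
    listing-complete = proj₁ (proj₂ (proj₂ (proj₂ count)))

    length-listing : length listing ≡ c
    length-listing = proj₂ (proj₂ (proj₂ (proj₂ count)))

  CountIs-⇔ : ∀ {m} {P Q : Subset m → Set} {c} →
              (∀ ℓ → P ℓ → Q ℓ) → (∀ ℓ → Q ℓ → P ℓ) → CountIs P c → CountIs Q c
  CountIs-⇔ P⇒Q Q⇒P (ℓs , unique , all , complete , length≡) =
    ℓs , unique , All.map (λ {ℓ} → P⇒Q ℓ) all , (λ ℓ q → complete ℓ (Q⇒P ℓ q)) , length≡

  CountIs-bijection : ∀ {m m′} {P : Subset m → Set} {Q : Subset m′ → Set} {c}
    (to : Subset m → Subset m′) (from : Subset m′ → Subset m) →
    (∀ ℓ → from (to ℓ) ≡ ℓ) → (∀ ℓ → to (from ℓ) ≡ ℓ) →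
    (∀ ℓ → P ℓ → Q (to ℓ)) → (∀ ℓ → Q ℓ → P (from ℓ)) → CountIs P c → CountIs Q c
  CountIs-bijection {Q = Q} to from from∘to to∘from P⇒Q Q⇒P (ℓs , unique , all , complete , length≡) =
    map to ℓs ,
    Unique.map⁺ to-injective unique ,
    All.map⁺ (All.map (λ {ℓ} → P⇒Q ℓ) all) ,
    (λ ℓ q → subst (_∈ map to ℓs) (to∘from ℓ) (∈-map⁺ to (complete (from ℓ) (Q⇒P ℓ q)))) ,
    trans (length-map to ℓs) length≡
    where
    to-injective : ∀ {ℓ ℓ′} → to ℓ ≡ to ℓ′ → ℓ ≡ ℓ′
    to-injective {ℓ} {ℓ′} eq = trans (sym (from∘to ℓ)) (trans (cong from eq) (from∘to ℓ′))

module Labellings {A : Set} where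

  open import Data.Nat using (ℕ; zero; suc; _+_; _≤_; _<_; z≤n; s≤s)
  open import Data.Bool using (true; false)
  open import Data.Product using (_×_; _,_; proj₁; proj₂; ∃-syntax)
  open import Data.Sum using (_⊎_; inj₁; inj₂)
  open import Data.Empty using (⊥)
  open import Data.Vec using ([]; _∷_; here; there)
  import Data.Fin as Fin
  open import Data.Fin.Subset using (Subset; ∣_∣) renaming (_∈_ to _∈ₛ_)
  open import Data.List using (List; []; _∷_; _++_; applyUpTo; length; lookup)
  open import Data.List.Relation.Unary.Any using (here; there)
  open import Data.List.Relation.Binary.Permutation.Propositional using (_↭_; refl; prep; swap; trans; ↭-sym)
  open import Data.List.Membership.Propositional using (_∈_)
  open import Relation.Binary.PropositionalEquality as ≡ using (_≡_; cong)
  open import Function using (_∘_)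

  -- A labelling of a duplicate-free list L (a subset of its positions) is a subset of its points.
  Selected : (L : List A) → Subset (length L) → A → Set
  Selected []      []      q = ⊥
  Selected (p ∷ L) (c ∷ ℓ) q = (p ≡ q × c ≡ true) ⊎ Selected L ℓ q

  Selected⇒∈ : ∀ (L : List A) ℓ {q} → Selected L ℓ q → q ∈ L
  Selected⇒∈ []      []      ()
  Selected⇒∈ (p ∷ L) (c ∷ ℓ) (inj₁ (≡.refl , _)) = here ≡.refl
  Selected⇒∈ (p ∷ L) (c ∷ ℓ) (inj₂ sel)           = there (Selected⇒∈ L ℓ sel)

  Selected⇒∃index : ∀ (L : List A) ℓ {q} → Selected L ℓ q → ∃[ i ] lookup L i ≡ q × i ∈ₛ ℓ
  Selected⇒∃index []      []      ()
  Selected⇒∃index (p ∷ L) (c ∷ ℓ) (inj₁ (≡.refl , ≡.refl)) = Fin.zero , ≡.refl , here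
  Selected⇒∃index (p ∷ L) (c ∷ ℓ) (inj₂ sel) =
    let i , eq , i∈ℓ = Selected⇒∃index L ℓ sel in Fin.suc i , eq , there i∈ℓ

  index⇒Selected : ∀ (L : List A) ℓ i {q} → lookup L i ≡ q → i ∈ₛ ℓ → Selected L ℓ q
  index⇒Selected (p ∷ L) (c ∷ ℓ) Fin.zero    eq here        = inj₁ (eq , ≡.refl)
  index⇒Selected (p ∷ L) (c ∷ ℓ) (Fin.suc i) eq (there i∈ℓ) = inj₂ (index⇒Selected L ℓ i eq i∈ℓ)

  relabel : ∀ {L L′ : List A} → L ↭ L′ → Subset (length L) → Subset (length L′)
  relabel refl           ℓ           = ℓ
  relabel (prep x π)     (c ∷ ℓ)     = c ∷ relabel π ℓ
  relabel (swap x y π)   (c ∷ d ∷ ℓ) = d ∷ c ∷ relabel π ℓ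
  relabel (trans π π′)   ℓ           = relabel π′ (relabel π ℓ)

  relabel-Selected : ∀ {L L′ : List A} (π : L ↭ L′) ℓ {q} → Selected L ℓ q → Selected L′ (relabel π ℓ) q
  relabel-Selected refl         ℓ           sel                   = sel
  relabel-Selected (prep x π)   (c ∷ ℓ)     (inj₁ sel)            = inj₁ sel
  relabel-Selected (prep x π)   (c ∷ ℓ)     (inj₂ sel)            = inj₂ (relabel-Selected π ℓ sel)
  relabel-Selected (swap x y π) (c ∷ d ∷ ℓ) (inj₁ sel)            = inj₂ (inj₁ sel)
  relabel-Selected (swap x y π) (c ∷ d ∷ ℓ) (inj₂ (inj₁ sel))     = inj₁ sel
  relabel-Selected (swap x y π) (c ∷ d ∷ ℓ) (inj₂ (inj₂ sel))     = inj₂ (inj₂ (relabel-Selected π ℓ sel))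
  relabel-Selected (trans π π′) ℓ           sel                   = relabel-Selected π′ _ (relabel-Selected π ℓ sel)

  relabel-inverseˡ : ∀ {L L′ : List A} (π : L ↭ L′) ℓ → relabel (↭-sym π) (relabel π ℓ) ≡ ℓ
  relabel-inverseˡ refl         ℓ           = ≡.refl
  relabel-inverseˡ (prep x π)   (c ∷ ℓ)     = cong (c ∷_) (relabel-inverseˡ π ℓ)
  relabel-inverseˡ (swap x y π) (c ∷ d ∷ ℓ) = cong (λ ℓ′ → c ∷ d ∷ ℓ′) (relabel-inverseˡ π ℓ)
  relabel-inverseˡ (trans π π′) ℓ           =
    ≡.trans (cong (relabel (↭-sym π)) (relabel-inverseˡ π′ (relabel π ℓ))) (relabel-inverseˡ π ℓ)

  relabel-inverseʳ : ∀ {L L′ : List A} (π : L ↭ L′) ℓ → relabel π (relabel (↭-sym π) ℓ) ≡ ℓ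
  relabel-inverseʳ refl         ℓ           = ≡.refl
  relabel-inverseʳ (prep x π)   (c ∷ ℓ)     = cong (c ∷_) (relabel-inverseʳ π ℓ)
  relabel-inverseʳ (swap x y π) (c ∷ d ∷ ℓ) = cong (λ ℓ′ → c ∷ d ∷ ℓ′) (relabel-inverseʳ π ℓ)
  relabel-inverseʳ (trans π π′) ℓ           =
    ≡.trans (cong (relabel π′) (relabel-inverseʳ π (relabel (↭-sym π′) ℓ))) (relabel-inverseʳ π′ ℓ)

  ∣relabel∣ : ∀ {L L′ : List A} (π : L ↭ L′) ℓ → ∣ relabel π ℓ ∣ ≡ ∣ ℓ ∣
  ∣relabel∣ refl         ℓ                   = ≡.refl
  ∣relabel∣ (prep x π)   (false ∷ ℓ)         = ∣relabel∣ π ℓ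
  ∣relabel∣ (prep x π)   (true ∷ ℓ)          = cong suc (∣relabel∣ π ℓ)
  ∣relabel∣ (swap x y π) (false ∷ false ∷ ℓ) = ∣relabel∣ π ℓ
  ∣relabel∣ (swap x y π) (false ∷ true ∷ ℓ)  = cong suc (∣relabel∣ π ℓ)
  ∣relabel∣ (swap x y π) (true ∷ false ∷ ℓ)  = cong suc (∣relabel∣ π ℓ)
  ∣relabel∣ (swap x y π) (true ∷ true ∷ ℓ)   = cong (suc ∘ suc) (∣relabel∣ π ℓ)
  ∣relabel∣ (trans π π′) ℓ                   = ≡.trans (∣relabel∣ π′ _) (∣relabel∣ π ℓ)

  join : ∀ (L₁ L₂ : List A) → Subset (length L₁) → Subset (length L₂) → Subset (length (L₁ ++ L₂))
  join []       L₂ []       ℓ₂ = ℓ₂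
  join (p ∷ L₁) L₂ (c ∷ ℓ₁) ℓ₂ = c ∷ join L₁ L₂ ℓ₁ ℓ₂

  split : ∀ (L₁ L₂ : List A) → Subset (length (L₁ ++ L₂)) → Subset (length L₁) × Subset (length L₂)
  split []       L₂ ℓ       = [] , ℓ
  split (p ∷ L₁) L₂ (c ∷ ℓ) = let ℓ₁ , ℓ₂ = split L₁ L₂ ℓ in c ∷ ℓ₁ , ℓ₂

  join-split : ∀ (L₁ L₂ : List A) ℓ → join L₁ L₂ (proj₁ (split L₁ L₂ ℓ)) (proj₂ (split L₁ L₂ ℓ)) ≡ ℓ
  join-split []       L₂ ℓ       = ≡.refl
  join-split (p ∷ L₁) L₂ (c ∷ ℓ) = cong (c ∷_) (join-split L₁ L₂ ℓ)

  split-join : ∀ (L₁ L₂ : List A) ℓ₁ ℓ₂ → split L₁ L₂ (join L₁ L₂ ℓ₁ ℓ₂) ≡ (ℓ₁ , ℓ₂)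
  split-join []       L₂ []       ℓ₂ = ≡.refl
  split-join (p ∷ L₁) L₂ (c ∷ ℓ₁) ℓ₂ = cong (λ (ℓ₁′ , ℓ₂′) → c ∷ ℓ₁′ , ℓ₂′) (split-join L₁ L₂ ℓ₁ ℓ₂)

  ∣join∣ : ∀ (L₁ L₂ : List A) ℓ₁ ℓ₂ → ∣ join L₁ L₂ ℓ₁ ℓ₂ ∣ ≡ ∣ ℓ₁ ∣ + ∣ ℓ₂ ∣
  ∣join∣ []       L₂ []           ℓ₂ = ≡.refl
  ∣join∣ (p ∷ L₁) L₂ (false ∷ ℓ₁) ℓ₂ = ∣join∣ L₁ L₂ ℓ₁ ℓ₂
  ∣join∣ (p ∷ L₁) L₂ (true ∷ ℓ₁)  ℓ₂ = cong suc (∣join∣ L₁ L₂ ℓ₁ ℓ₂)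

  Selected-join⁻ : ∀ (L₁ L₂ : List A) ℓ₁ ℓ₂ {q} → Selected (L₁ ++ L₂) (join L₁ L₂ ℓ₁ ℓ₂) q →
                   Selected L₁ ℓ₁ q ⊎ Selected L₂ ℓ₂ q
  Selected-join⁻ []       L₂ []       ℓ₂ sel        = inj₂ sel
  Selected-join⁻ (p ∷ L₁) L₂ (c ∷ ℓ₁) ℓ₂ (inj₁ sel) = inj₁ (inj₁ sel)
  Selected-join⁻ (p ∷ L₁) L₂ (c ∷ ℓ₁) ℓ₂ (inj₂ sel) with Selected-join⁻ L₁ L₂ ℓ₁ ℓ₂ sel
  ... | inj₁ sel₁ = inj₁ (inj₂ sel₁)
  ... | inj₂ sel₂ = inj₂ sel₂

  Selected-joinˡ : ∀ (L₁ L₂ : List A) ℓ₁ ℓ₂ {q} → Selected L₁ ℓ₁ q → Selected (L₁ ++ L₂) (join L₁ L₂ ℓ₁ ℓ₂) q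
  Selected-joinˡ []       L₂ []       ℓ₂ ()
  Selected-joinˡ (p ∷ L₁) L₂ (c ∷ ℓ₁) ℓ₂ (inj₁ sel) = inj₁ sel
  Selected-joinˡ (p ∷ L₁) L₂ (c ∷ ℓ₁) ℓ₂ (inj₂ sel) = inj₂ (Selected-joinˡ L₁ L₂ ℓ₁ ℓ₂ sel)

  Selected-joinʳ : ∀ (L₁ L₂ : List A) ℓ₁ ℓ₂ {q} → Selected L₂ ℓ₂ q → Selected (L₁ ++ L₂) (join L₁ L₂ ℓ₁ ℓ₂) q
  Selected-joinʳ []       L₂ []       ℓ₂ sel = sel
  Selected-joinʳ (p ∷ L₁) L₂ (c ∷ ℓ₁) ℓ₂ sel = inj₂ (Selected-joinʳ L₁ L₂ ℓ₁ ℓ₂ sel)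

  prefix : (L : List A) → ℕ → Subset (length L)
  prefix []      k       = []
  prefix (p ∷ L) zero    = false ∷ prefix L zero
  prefix (p ∷ L) (suc k) = true ∷ prefix L k

  ∣prefix∣ : ∀ (L : List A) k → k ≤ length L → ∣ prefix L k ∣ ≡ k
  ∣prefix∣ []      zero    _         = ≡.refl
  ∣prefix∣ (p ∷ L) zero    _         = ∣prefix∣ L zero z≤n
  ∣prefix∣ (p ∷ L) (suc k) (s≤s k≤) = cong suc (∣prefix∣ L k k≤)

  Selected-prefix⁺ : ∀ g m k t → t < k → t < m → Selected (applyUpTo g m) (prefix (applyUpTo g m) k) (g t)
  Selected-prefix⁺ g (suc m) (suc k) zero    _         _         = inj₁ (≡.refl , ≡.refl)
  Selected-prefix⁺ g (suc m) (suc k) (suc t) (s≤s t<k) (s≤s t<m) = inj₂ (Selected-prefix⁺ (g ∘ suc) m k t t<k t<m)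

  Selected-prefix⁻ : ∀ g m k {v} → Selected (applyUpTo g m) (prefix (applyUpTo g m) k) v →
                     ∃[ t ] t < k × t < m × v ≡ g t
  Selected-prefix⁻ g (suc m) zero    (inj₁ (_ , ()))
  Selected-prefix⁻ g (suc m) zero    (inj₂ sel)
    with _ , () , _ ← Selected-prefix⁻ (g ∘ suc) m zero sel
  Selected-prefix⁻ g (suc m) (suc k) (inj₁ (≡.refl , _)) = zero , s≤s z≤n , s≤s z≤n , ≡.refl
  Selected-prefix⁻ g (suc m) (suc k) (inj₂ sel)
    with t , t<k , t<m , ≡.refl ← Selected-prefix⁻ (g ∘ suc) m k sel = suc t , s≤s t<k , s≤s t<m , ≡.refl

module DownSets {A : Set} (_⋖_ : A → A → Set) where

  open Counting
  open ListFacts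
  open Labellings
  open import Data.Nat using (ℕ; zero; suc; _+_; _*_; _∸_; _≤_; _<_; z≤n; s≤s; _≤?_)
  open import Data.Nat.Properties using (m+[n∸m]≡n; m+n∸m≡n; m≤m+n; ≤-pred; <⇒≤; +-cancelʳ-≡; <-trans; n<1+n; m≢1+n+m)
  open import Data.Nat.ListAction using (sum)
  open import Data.Bool using (true; false)
  open import Data.Product using (_×_; _,_; proj₁; proj₂; ∃-syntax)
  open import Data.Sum using (inj₁; inj₂)
  open import Data.Empty using (⊥; ⊥-elim)
  open import Data.Vec using ([]; _∷_)
  open import Data.Fin.Subset using (Subset; ∣_∣)
  open import Data.Fin.Subset.Properties using (∣p∣≤n)
  open import Relation.Nullary using (yes; no)
  open import Data.List using (List; []; _∷_; _++_; [_]; map; concatMap; upTo; applyUpTo; length)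
  open import Data.List.Properties using (length-map; length-applyUpTo; map-cong)
  import Data.List.Relation.Unary.All as All
  open import Data.List.Relation.Unary.Any using (here; there)
  open import Data.List.Relation.Unary.AllPairs using ([]; _∷_)
  open import Data.List.Relation.Unary.Unique.Propositional using (Unique)
  import Data.List.Relation.Unary.Unique.Propositional.Properties as Unique
  open import Data.List.Relation.Binary.Disjoint.Propositional using (Disjoint)
  open import Data.List.Relation.Binary.Permutation.Propositional using (_↭_; ↭-sym)
  open import Data.List.Relation.Binary.Permutation.Propositional.Properties using (∈-resp-↭)
  open import Data.List.Membership.Propositional using (_∈_)
  open import Data.List.Membership.Propositional.Properties
    using (∈-++⁺ˡ; ∈-++⁺ʳ; ∈-++⁻; ∈-map⁺; ∈-map⁻; ∈-upTo⁺; ∈-upTo⁻; ∈-applyUpTo⁻)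
  open import Relation.Binary.PropositionalEquality as ≡ using (_≡_; cong; cong₂; subst; subst₂; sym)
  open import Function using (_∘_)

  IsDownSet : (L : List A) → Subset (length L) → Set
  IsDownSet L ℓ = ∀ {u v} → u ∈ L → u ⋖ v → Selected L ℓ v → Selected L ℓ u

  HasDownSetGF : List A → Poly → Set
  HasDownSetGF L f = ∀ k → CountIs (λ ℓ → IsDownSet L ℓ × ∣ ℓ ∣ ≡ k) (f k)

  HasDownSetGF-resp-≈P : ∀ {L f h} → f ≈P h → HasDownSetGF L f → HasDownSetGF L h
  HasDownSetGF-resp-≈P f≈h gf k with ℓs , unique , all , complete , length≡ ← gf k =
    ℓs , unique , all , complete , ≡.trans length≡ (f≈h k)

  HasDownSetGF-[] : HasDownSetGF [] oneP
  HasDownSetGF-[] zero    =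
    [] ∷ [] , All.[] ∷ [] , ((λ ()) , ≡.refl) All.∷ All.[] , (λ { [] _ → here ≡.refl }) , ≡.refl
  HasDownSetGF-[] (suc k) = [] , [] , All.[] , (λ { [] (_ , ()) }) , ≡.refl

  relabel-IsDownSet : ∀ {L L′ : List A} (π : L ↭ L′) ℓ → IsDownSet L ℓ → IsDownSet L′ (relabel π ℓ)
  relabel-IsDownSet {L} π ℓ down {u} {v} u∈L′ u⋖v v-sel =
    relabel-Selected π ℓ (down (∈-resp-↭ (↭-sym π) u∈L′) u⋖v v-sel′)
    where
    v-sel′ : Selected L ℓ v
    v-sel′ = subst (λ ℓ′ → Selected L ℓ′ v) (relabel-inverseˡ π ℓ) (relabel-Selected (↭-sym π) _ v-sel)

  HasDownSetGF-↭ : ∀ {L L′ : List A} {f} → L ↭ L′ → HasDownSetGF L f → HasDownSetGF L′ f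
  HasDownSetGF-↭ {L} {L′} π gf k =
    CountIs-bijection {P = DownSetOfSize L} {Q = DownSetOfSize L′} (relabel π) (relabel (↭-sym π))
      (relabel-inverseˡ π) (relabel-inverseʳ π) (transfer π) (transfer (↭-sym π)) (gf k)
    where
    DownSetOfSize : (M : List A) → Subset (length M) → Set
    DownSetOfSize M ℓ = IsDownSet M ℓ × ∣ ℓ ∣ ≡ k
    transfer : ∀ {M M′ : List A} (σ : M ↭ M′) ℓ → DownSetOfSize M ℓ → DownSetOfSize M′ (relabel σ ℓ)
    transfer σ ℓ (down , size) = relabel-IsDownSet σ ℓ down , ≡.trans (∣relabel∣ σ ℓ) size

  Closed : List A → Set
  Closed L = ∀ {u v} → u ∈ L → u ⋖ v → v ∈ L

  module Join (L₁ L₂ : List A) (disjoint : Disjoint L₁ L₂) (closed₁ : Closed L₁) (closed₂ : Closed L₂) where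

    IsDownSet-join⁻ : ∀ ℓ₁ ℓ₂ → IsDownSet (L₁ ++ L₂) (join L₁ L₂ ℓ₁ ℓ₂) → IsDownSet L₁ ℓ₁ × IsDownSet L₂ ℓ₂
    IsDownSet-join⁻ ℓ₁ ℓ₂ down = down₁ , down₂
      where
      down₁ : IsDownSet L₁ ℓ₁
      down₁ u∈ u⋖v v-sel with Selected-join⁻ L₁ L₂ ℓ₁ ℓ₂ (down (∈-++⁺ˡ u∈) u⋖v (Selected-joinˡ L₁ L₂ ℓ₁ ℓ₂ v-sel))
      ... | inj₁ u-sel = u-sel
      ... | inj₂ u-sel = ⊥-elim (disjoint (u∈ , Selected⇒∈ L₂ ℓ₂ u-sel))
      down₂ : IsDownSet L₂ ℓ₂
      down₂ u∈ u⋖v v-sel with Selected-join⁻ L₁ L₂ ℓ₁ ℓ₂ (down (∈-++⁺ʳ L₁ u∈) u⋖v (Selected-joinʳ L₁ L₂ ℓ₁ ℓ₂ v-sel))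
      ... | inj₁ u-sel = ⊥-elim (disjoint (Selected⇒∈ L₁ ℓ₁ u-sel , u∈))
      ... | inj₂ u-sel = u-sel

    IsDownSet-join⁺ : ∀ ℓ₁ ℓ₂ → IsDownSet L₁ ℓ₁ → IsDownSet L₂ ℓ₂ → IsDownSet (L₁ ++ L₂) (join L₁ L₂ ℓ₁ ℓ₂)
    IsDownSet-join⁺ ℓ₁ ℓ₂ down₁ down₂ u∈ u⋖v v-sel with ∈-++⁻ L₁ u∈ | Selected-join⁻ L₁ L₂ ℓ₁ ℓ₂ v-sel
    ... | inj₁ u∈₁ | inj₁ v-sel₁ = Selected-joinˡ L₁ L₂ ℓ₁ ℓ₂ (down₁ u∈₁ u⋖v v-sel₁)
    ... | inj₁ u∈₁ | inj₂ v-sel₂ = ⊥-elim (disjoint (closed₁ u∈₁ u⋖v , Selected⇒∈ L₂ ℓ₂ v-sel₂))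
    ... | inj₂ u∈₂ | inj₁ v-sel₁ = ⊥-elim (disjoint (Selected⇒∈ L₁ ℓ₁ v-sel₁ , closed₂ u∈₂ u⋖v))
    ... | inj₂ u∈₂ | inj₂ v-sel₂ = Selected-joinʳ L₁ L₂ ℓ₁ ℓ₂ (down₂ u∈₂ u⋖v v-sel₂)

    joins : List (Subset (length L₁)) → List (Subset (length L₂)) → List (Subset (length (L₁ ++ L₂)))
    joins ℓs₁ ℓs₂ = concatMap (λ ℓ₁ → map (join L₁ L₂ ℓ₁) ℓs₂) ℓs₁

    ∈-joins⁺ : ∀ {ℓs₁ ℓs₂ ℓ₁ ℓ₂} → ℓ₁ ∈ ℓs₁ → ℓ₂ ∈ ℓs₂ → join L₁ L₂ ℓ₁ ℓ₂ ∈ joins ℓs₁ ℓs₂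
    ∈-joins⁺ ℓ₁∈ ℓ₂∈ = ∈-concatMap⁺′ _ ℓ₁∈ (∈-map⁺ _ ℓ₂∈)

    ∈-joins⁻ : ∀ ℓs₁ ℓs₂ {ℓ} → ℓ ∈ joins ℓs₁ ℓs₂ →
               ∃[ ℓ₁ ] ∃[ ℓ₂ ] ℓ₁ ∈ ℓs₁ × ℓ₂ ∈ ℓs₂ × ℓ ≡ join L₁ L₂ ℓ₁ ℓ₂
    ∈-joins⁻ ℓs₁ ℓs₂ ℓ∈ =
      let ℓ₁ , ℓ₁∈ , ℓ∈map = ∈-concatMap⁻′ _ ℓs₁ ℓ∈
          ℓ₂ , ℓ₂∈ , ℓ≡    = ∈-map⁻ (join L₁ L₂ ℓ₁) ℓ∈map
      in ℓ₁ , ℓ₂ , ℓ₁∈ , ℓ₂∈ , ℓ≡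

    Unique-joins : ∀ {ℓs₁ ℓs₂} → Unique ℓs₁ → Unique ℓs₂ → Unique (joins ℓs₁ ℓs₂)
    Unique-joins {ℓs₁} {ℓs₂} unique₁ unique₂ =
      Unique-concatMap⁺ _ ℓs₁ unique₁ (λ ℓ₁ _ → Unique.map⁺ (join-injectiveʳ ℓ₁) unique₂) same-left
      where
      join-injectiveʳ : ∀ ℓ₁ {ℓ₂ ℓ₂′} → join L₁ L₂ ℓ₁ ℓ₂ ≡ join L₁ L₂ ℓ₁ ℓ₂′ → ℓ₂ ≡ ℓ₂′
      join-injectiveʳ ℓ₁ {ℓ₂} {ℓ₂′} eq = cong proj₂ (≡.trans (sym (split-join L₁ L₂ ℓ₁ ℓ₂))
                                              (≡.trans (cong (split L₁ L₂) eq) (split-join L₁ L₂ ℓ₁ ℓ₂′)))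
      same-left : ∀ ℓ₁ ℓ₁′ ℓ → ℓ₁ ∈ ℓs₁ → ℓ₁′ ∈ ℓs₁ →
                  ℓ ∈ map (join L₁ L₂ ℓ₁) ℓs₂ → ℓ ∈ map (join L₁ L₂ ℓ₁′) ℓs₂ → ℓ₁ ≡ ℓ₁′
      same-left ℓ₁ ℓ₁′ ℓ _ _ ℓ∈ ℓ∈′ =
        let ℓ₂ , _ , ℓ≡ = ∈-map⁻ (join L₁ L₂ ℓ₁) ℓ∈ ; ℓ₂′ , _ , ℓ≡′ = ∈-map⁻ (join L₁ L₂ ℓ₁′) ℓ∈′
        in cong proj₁ (≡.trans (sym (split-join L₁ L₂ ℓ₁ ℓ₂))
                        (≡.trans (cong (split L₁ L₂) (≡.trans (sym ℓ≡) ℓ≡′)) (split-join L₁ L₂ ℓ₁′ ℓ₂′)))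

    length-joins : ∀ ℓs₁ ℓs₂ → length (joins ℓs₁ ℓs₂) ≡ length ℓs₁ * length ℓs₂
    length-joins ℓs₁ ℓs₂ =
      ≡.trans (length-concatMap _ ℓs₁)
        (≡.trans (cong sum (map-cong (λ ℓ₁ → length-map (join L₁ L₂ ℓ₁) ℓs₂) ℓs₁)) (sum-map-const ℓs₁ (length ℓs₂)))

    module _ {f₁ f₂ : Poly} (gf₁ : HasDownSetGF L₁ f₁) (gf₂ : HasDownSetGF L₂ f₂) (k : ℕ) where

      -- A down set of L₁ ++ L₂ of size k is the join of down sets of sizes i ≤ k and k ∸ i.
      block : ℕ → List (Subset (length (L₁ ++ L₂)))
      block i = joins (listing (gf₁ i)) (listing (gf₂ (k ∸ i)))

      candidates : List (Subset (length (L₁ ++ L₂)))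
      candidates = concatMap block (upTo (suc k))

      ∈-block⁻ : ∀ i {ℓ} → ℓ ∈ block i → ∃[ ℓ₁ ] ∃[ ℓ₂ ]
                 (IsDownSet L₁ ℓ₁ × ∣ ℓ₁ ∣ ≡ i) × (IsDownSet L₂ ℓ₂ × ∣ ℓ₂ ∣ ≡ k ∸ i) × ℓ ≡ join L₁ L₂ ℓ₁ ℓ₂
      ∈-block⁻ i ℓ∈ =
        let ℓ₁ , ℓ₂ , ℓ₁∈ , ℓ₂∈ , ℓ≡ = ∈-joins⁻ (listing (gf₁ i)) (listing (gf₂ (k ∸ i))) ℓ∈
        in ℓ₁ , ℓ₂ , All.lookup (listing-sound (gf₁ i)) ℓ₁∈ , All.lookup (listing-sound (gf₂ (k ∸ i))) ℓ₂∈ , ℓ≡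

      ∣left∣-block : ∀ i {ℓ} → ℓ ∈ block i → ∣ proj₁ (split L₁ L₂ ℓ) ∣ ≡ i
      ∣left∣-block i ℓ∈ with ℓ₁ , ℓ₂ , (_ , ∣ℓ₁∣≡i) , _ , ≡.refl ← ∈-block⁻ i ℓ∈ =
        ≡.trans (cong (∣_∣ ∘ proj₁) (split-join L₁ L₂ ℓ₁ ℓ₂)) ∣ℓ₁∣≡i

      candidates-unique : Unique candidates
      candidates-unique = Unique-concatMap⁺ block (upTo (suc k)) (Unique.upTo⁺ (suc k))
        (λ i _ → Unique-joins (listing-unique (gf₁ i)) (listing-unique (gf₂ (k ∸ i))))
        (λ i i′ _ _ _ ℓ∈ ℓ∈′ → ≡.trans (sym (∣left∣-block i ℓ∈)) (∣left∣-block i′ ℓ∈′))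

      candidates-sound : All.All (λ ℓ → IsDownSet (L₁ ++ L₂) ℓ × ∣ ℓ ∣ ≡ k) candidates
      candidates-sound = All.tabulate λ ℓ∈ →
        let i , i∈ , ℓ∈block = ∈-concatMap⁻′ block (upTo (suc k)) ℓ∈
            ℓ₁ , ℓ₂ , (down₁ , ∣ℓ₁∣≡i) , (down₂ , ∣ℓ₂∣≡k∸i) , ℓ≡ = ∈-block⁻ i ℓ∈block
        in subst (λ ℓ → IsDownSet (L₁ ++ L₂) ℓ × ∣ ℓ ∣ ≡ k) (sym ℓ≡)
             ( (λ {u v} → IsDownSet-join⁺ ℓ₁ ℓ₂ down₁ down₂ {u} {v})
             , ≡.trans (∣join∣ L₁ L₂ ℓ₁ ℓ₂)
                 (≡.trans (cong₂ _+_ ∣ℓ₁∣≡i ∣ℓ₂∣≡k∸i) (m+[n∸m]≡n (≤-pred (∈-upTo⁻ i∈)))))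

      candidates-complete : ∀ ℓ → IsDownSet (L₁ ++ L₂) ℓ × ∣ ℓ ∣ ≡ k → ℓ ∈ candidates
      candidates-complete ℓ (down , ∣ℓ∣≡k) =
        subst (_∈ candidates) (join-split L₁ L₂ ℓ)
          (∈-concatMap⁺′ block (∈-upTo⁺ (s≤s i≤k))
            (∈-joins⁺ (listing-complete (gf₁ i) ℓ₁ (down₁ , ≡.refl))
                      (listing-complete (gf₂ (k ∸ i)) ℓ₂ (down₂ , ∣ℓ₂∣≡k∸i))))
        where
        ℓ₁ = proj₁ (split L₁ L₂ ℓ)
        ℓ₂ = proj₂ (split L₁ L₂ ℓ)
        i  = ∣ ℓ₁ ∣
        down₁₂ = IsDownSet-join⁻ ℓ₁ ℓ₂ (subst (IsDownSet (L₁ ++ L₂)) (sym (join-split L₁ L₂ ℓ)) down)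
        down₁ = proj₁ down₁₂
        down₂ = proj₂ down₁₂
        i+∣ℓ₂∣≡k : i + ∣ ℓ₂ ∣ ≡ k
        i+∣ℓ₂∣≡k = ≡.trans (sym (∣join∣ L₁ L₂ ℓ₁ ℓ₂)) (≡.trans (cong ∣_∣ (join-split L₁ L₂ ℓ)) ∣ℓ∣≡k)
        ∣ℓ₂∣≡k∸i : ∣ ℓ₂ ∣ ≡ k ∸ i
        ∣ℓ₂∣≡k∸i = ≡.trans (sym (m+n∸m≡n i ∣ ℓ₂ ∣)) (cong (_∸ i) i+∣ℓ₂∣≡k)
        i≤k : i ≤ k
        i≤k = subst (i ≤_) i+∣ℓ₂∣≡k (m≤m+n i ∣ ℓ₂ ∣)

      length-candidates : length candidates ≡ (f₁ *P f₂) k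
      length-candidates =
        ≡.trans (length-concatMap block (upTo (suc k))) (cong sum (map-cong (λ i →
          ≡.trans (length-joins (listing (gf₁ i)) (listing (gf₂ (k ∸ i))))
                  (cong₂ _*_ (length-listing (gf₁ i)) (length-listing (gf₂ (k ∸ i))))) (upTo (suc k))))

    HasDownSetGF-++ : ∀ {f₁ f₂} → HasDownSetGF L₁ f₁ → HasDownSetGF L₂ f₂ → HasDownSetGF (L₁ ++ L₂) (f₁ *P f₂)
    HasDownSetGF-++ gf₁ gf₂ k =
      candidates gf₁ gf₂ k , candidates-unique gf₁ gf₂ k , candidates-sound gf₁ gf₂ k ,
      candidates-complete gf₁ gf₂ k , length-candidates gf₁ gf₂ k

  Closed-concatMap : ∀ {B : Set} (G : B → List A) xs → (∀ b → b ∈ xs → Closed (G b)) → Closed (concatMap G xs)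
  Closed-concatMap G xs closed u∈ u⋖v =
    let b , b∈ , u∈Gb = ∈-concatMap⁻′ G xs u∈ in ∈-concatMap⁺′ G b∈ (closed b b∈ u∈Gb u⋖v)

  HasDownSetGF-concatMap : ∀ {B : Set} (G : B → List A) (f : B → Poly) xs →
    Unique (concatMap G xs) → (∀ b → b ∈ xs → Closed (G b)) → (∀ b → b ∈ xs → HasDownSetGF (G b) (f b)) →
    HasDownSetGF (concatMap G xs) (prodP (map f xs))
  HasDownSetGF-concatMap G f []       _      _      _  = HasDownSetGF-[]
  HasDownSetGF-concatMap G f (b ∷ xs) unique closed gf =
    Join.HasDownSetGF-++ (G b) (concatMap G xs) (Unique-++⇒Disjoint (G b) unique)
      (closed b (here ≡.refl)) (Closed-concatMap G xs (λ b′ → closed b′ ∘ there))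
      (gf b (here ≡.refl))
      (HasDownSetGF-concatMap G f xs (Unique-++⁻ʳ (G b) unique) (λ b′ → closed b′ ∘ there) (λ b′ → gf b′ ∘ there))

  module Chain (rank : A → ℕ) (rank-⋖ : ∀ {u v} → u ⋖ v → rank v ≡ suc (rank u)) where

    IsChain : (ℕ → A) → ℕ → Set
    IsChain g m = ∀ t → suc t < m → g t ⋖ g (suc t)

    IsChain-tail : ∀ {g m} → IsChain g (suc m) → IsChain (g ∘ suc) m
    IsChain-tail chain t = chain (suc t) ∘ s≤s

    rank-chain : ∀ g m → IsChain g m → ∀ t → t < m → rank (g t) ≡ t + rank (g 0)
    rank-chain g m chain zero    _   = ≡.refl
    rank-chain g m chain (suc t) t<m =
      ≡.trans (rank-⋖ (chain t t<m)) (cong suc (rank-chain g m chain t (<-trans (n<1+n t) t<m)))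

    head∉tail : ∀ g m → IsChain g (suc m) → g 0 ∈ applyUpTo (g ∘ suc) m → ⊥
    head∉tail g m chain g0∈ with t , t<m , g0≡ ← ∈-applyUpTo⁻ (g ∘ suc) g0∈ =
      m≢1+n+m (rank (g 0)) (≡.trans (cong rank g0≡) (rank-chain g (suc m) chain (suc t) (s≤s t<m)))

    prefix-IsDownSet : ∀ g m → IsChain g m → ∀ k → IsDownSet (applyUpTo g m) (prefix (applyUpTo g m) k)
    prefix-IsDownSet g m chain k {u} u∈ u⋖v v-sel
      with s , s<m , ≡.refl ← ∈-applyUpTo⁻ g u∈
         | t , t<k , t<m , ≡.refl ← Selected-prefix⁻ g m k v-sel =
      Selected-prefix⁺ g m k s (<⇒≤ (subst (_< k) t≡1+s t<k)) s<m
      where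
      t≡1+s : t ≡ suc s
      t≡1+s = +-cancelʳ-≡ (rank (g 0)) t (suc s) (begin
        t + rank (g 0)       ≡⟨ rank-chain g m chain t t<m ⟨
        rank (g t)           ≡⟨ rank-⋖ u⋖v ⟩
        suc (rank (g s))     ≡⟨ cong suc (rank-chain g m chain s s<m) ⟩
        suc (s + rank (g 0)) ∎)
        where open ≡.≡-Reasoning

    IsDownSet-tail : ∀ g m → IsChain g (suc m) → ∀ c ℓ → IsDownSet (applyUpTo g (suc m)) (c ∷ ℓ) →
                     IsDownSet (applyUpTo (g ∘ suc) m) ℓ
    IsDownSet-tail g m chain c ℓ down u∈ u⋖v v-sel with down (there u∈) u⋖v (inj₂ v-sel)
    ... | inj₁ (≡.refl , _) = ⊥-elim (head∉tail g m chain u∈)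
    ... | inj₂ u-sel        = u-sel

    unselected-head⇒∣tail∣≡0 : ∀ g m → IsChain g (suc m) → ∀ ℓ →
      IsDownSet (applyUpTo g (suc m)) (false ∷ ℓ) → ℓ ≡ prefix (applyUpTo (g ∘ suc) m) ∣ ℓ ∣ → ∣ ℓ ∣ ≡ 0
    unselected-head⇒∣tail∣≡0 g zero    chain [] down ℓ≡ = ≡.refl
    unselected-head⇒∣tail∣≡0 g (suc m) chain ℓ  down ℓ≡ with ∣ ℓ ∣ | ℓ≡
    ... | zero  | _    = ≡.refl
    ... | suc j | ≡.refl with down (here ≡.refl) (chain 0 (s≤s (s≤s z≤n)))
                                 (inj₂ (Selected-prefix⁺ (g ∘ suc) (suc m) (suc j) 0 (s≤s z≤n) (s≤s z≤n)))
    ...   | inj₂ g0-sel = ⊥-elim (head∉tail g (suc m) chain (Selected⇒∈ _ _ g0-sel))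

    IsDownSet⇒≡prefix : ∀ g m → IsChain g m → ∀ ℓ → IsDownSet (applyUpTo g m) ℓ →
                        ℓ ≡ prefix (applyUpTo g m) ∣ ℓ ∣
    IsDownSet⇒≡prefix g zero    chain []        down = ≡.refl
    IsDownSet⇒≡prefix g (suc m) chain (true ∷ ℓ) down =
      cong (true ∷_) (IsDownSet⇒≡prefix (g ∘ suc) m (IsChain-tail chain) ℓ (IsDownSet-tail g m chain true ℓ down))
    IsDownSet⇒≡prefix g (suc m) chain (false ∷ ℓ) down = begin
      false ∷ ℓ                  ≡⟨ cong (false ∷_) (≡.trans ℓ≡ (cong (prefix tail) ∣ℓ∣≡0)) ⟩
      false ∷ prefix tail 0      ≡⟨ cong (prefix (g 0 ∷ tail)) ∣ℓ∣≡0 ⟨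
      prefix (g 0 ∷ tail) ∣ ℓ ∣  ∎
      where
      open ≡.≡-Reasoning
      tail = applyUpTo (g ∘ suc) m
      ℓ≡ : ℓ ≡ prefix tail ∣ ℓ ∣
      ℓ≡ = IsDownSet⇒≡prefix (g ∘ suc) m (IsChain-tail chain) ℓ (IsDownSet-tail g m chain false ℓ down)
      ∣ℓ∣≡0 : ∣ ℓ ∣ ≡ 0
      ∣ℓ∣≡0 = unselected-head⇒∣tail∣≡0 g m chain ℓ down ℓ≡

    HasDownSetGF-chain : ∀ g m → IsChain g m → HasDownSetGF (applyUpTo g m) (qint (suc m))
    HasDownSetGF-chain g m chain k with suc k ≤? suc m
    ... | yes (s≤s k≤m) =
      [ prefix L k ] , All.[] ∷ [] ,
      ((λ {u v} → prefix-IsDownSet g m chain k {u} {v}) ,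
       ∣prefix∣ L k (subst (k ≤_) (sym (length-applyUpTo g m)) k≤m)) All.∷ All.[] ,
      (λ ℓ (down , ∣ℓ∣≡k) → here (≡.trans (IsDownSet⇒≡prefix g m chain ℓ down) (cong (prefix L) ∣ℓ∣≡k))) ,
      ≡.refl
      where L = applyUpTo g m
    ... | no k≰m =
      [] , [] , All.[] ,
      (λ ℓ (_ , ∣ℓ∣≡k) → ⊥-elim (k≰m (s≤s (subst₂ _≤_ ∣ℓ∣≡k (length-applyUpTo g m) (∣p∣≤n ℓ))))) ,
      ≡.refl

module ChainIndices where

  open import Data.Nat using (ℕ; suc; _+_; _∸_; _≤_; _<_; s≤s)
  open import Data.Nat.Properties
  open import Data.Nat.Tactic.RingSolver using (solve-∀)
  open import Data.Product using (_×_; _,_; ∃-syntax)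
  open import Relation.Binary.PropositionalEquality hiding (J)

  -- Coordinates of the t-th point of the chain (J, I): for an axis colour e_i, coordinate i is t
  -- and the others are J ∸ I and n ∸ suc J; for a difference colour e_j − e_i, coordinate i is
  -- I ∸ suc t, coordinate j is t and the third is J ∸ I.
  ChainIndex : ℕ → ℕ → ℕ → ℕ → Set
  ChainIndex n J I t = t < I × I ≤ J × J < n

  offAxis-sum : ∀ {n J I} → I ≤ J → J < n → (J ∸ I) + (n ∸ suc J) + suc I ≡ n
  offAxis-sum {n} {J} {I} I≤J J<n = begin
    X + Y + suc I    ≡⟨ regroup X Y I ⟩
    suc (I + X) + Y  ≡⟨ cong (λ j → suc j + Y) (m+[n∸m]≡n I≤J) ⟩
    suc J + Y        ≡⟨ m+[n∸m]≡n J<n ⟩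
    n                ∎
    where
    open ≡-Reasoning
    X = J ∸ I
    Y = n ∸ suc J
    regroup : ∀ X Y I → X + Y + suc I ≡ suc (I + X) + Y
    regroup = solve-∀

  plus-two : ∀ s t → s + t + 2 ≡ s + suc (suc t)
  plus-two = solve-∀

  axis-∈ : ∀ {n J I t} → ChainIndex n J I t → (J ∸ I) + (n ∸ suc J) + t + 2 ≤ n
  axis-∈ {n} {J} {I} {t} (t<I , I≤J , J<n) =
    subst₂ _≤_ (sym (plus-two _ t)) (offAxis-sum I≤J J<n) (+-monoʳ-≤ ((J ∸ I) + (n ∸ suc J)) (s≤s t<I))

  axis-top : ∀ {n J I t} → ChainIndex n J I t → (J ∸ I) + (n ∸ suc J) + suc t + 2 ≤ n → suc t < I
  axis-top {n} {J} {I} {t} (_ , I≤J , J<n) in-triangle =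
    ≤-pred (+-cancelˡ-≤ ((J ∸ I) + (n ∸ suc J)) _ _
      (subst₂ _≤_ (plus-two _ (suc t)) (sym (offAxis-sum I≤J J<n)) in-triangle))

  axis-injective : ∀ {n J I t J′ I′ t′} → ChainIndex n J I t → ChainIndex n J′ I′ t′ →
                   J ∸ I ≡ J′ ∸ I′ → n ∸ suc J ≡ n ∸ suc J′ → J ≡ J′ × I ≡ I′
  axis-injective {I′ = I′} (_ , I≤J , J<n) (_ , I′≤J′ , J′<n) X≡ Y≡ =
    let J≡J′ = suc-injective (∸-cancelˡ-≡ J<n J′<n Y≡) in
    J≡J′ , ∸-cancelˡ-≡ I≤J (subst (I′ ≤_) (sym J≡J′) I′≤J′) (trans X≡ (cong (_∸ I′) (sym J≡J′)))

  axis-surjective : ∀ {n} X Y t → X + Y + t + 2 ≤ n →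
                    ∃[ J ] ∃[ I ] ChainIndex n J I t × J ∸ I ≡ X × n ∸ suc J ≡ Y
  axis-surjective {n} X Y t in-triangle with e , refl ← m≤n⇒∃[o]m+o≡n in-triangle =
    J , I , (s≤s (m≤m+n t e) , m≤n+m I X , J<n) , m+n∸n≡m X I ,
    trans (cong (_∸ suc J) (sym sum≡)) (m+n∸m≡n (suc J) Y)
    where
    I = suc t + e
    J = X + I
    sum≡ : suc J + Y ≡ X + Y + t + 2 + e
    sum≡ = lemma X Y t e
      where
      lemma : ∀ X Y t e → suc (X + (suc t + e)) + Y ≡ X + Y + t + 2 + e
      lemma = solve-∀
    J<n : J < X + Y + t + 2 + e
    J<n = subst (suc J ≤_) sum≡ (m≤m+n (suc J) Y)

  diff-coordinate-sum : ∀ U t V → U + t + V + 2 ≡ suc (suc t + U + V)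
  diff-coordinate-sum = solve-∀

  diff-∈ : ∀ {n J I t} → ChainIndex n J I t → (I ∸ suc t) + t + (J ∸ I) + 2 ≤ n
  diff-∈ {n} {J} {I} {t} (t<I , I≤J , J<n) = subst (_≤ n) (sym (begin
    U + t + V + 2        ≡⟨ diff-coordinate-sum U t V ⟩
    suc (suc t + U + V)  ≡⟨ cong (λ i → suc (i + V)) (m+[n∸m]≡n t<I) ⟩
    suc (I + V)          ≡⟨ cong suc (m+[n∸m]≡n I≤J) ⟩
    suc J                ∎)) J<n
    where
    open ≡-Reasoning
    U = I ∸ suc t
    V = J ∸ I

  diff-top : ∀ I t {a} → I ∸ suc t ≡ suc a → suc t < I
  diff-top I t eq = m∸n≢0⇒n<m (λ eq′ → 0≢1+n (trans (sym eq′) eq))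

  diff-step : ∀ {I t} → suc t < I → I ∸ suc t ≡ suc (I ∸ suc (suc t))
  diff-step {suc (suc K)} (s≤s (s≤s t≤K)) = +-∸-assoc 1 t≤K

  diff-injective : ∀ {n J I t J′ I′} → ChainIndex n J I t → ChainIndex n J′ I′ t →
                   I ∸ suc t ≡ I′ ∸ suc t → J ∸ I ≡ J′ ∸ I′ → J ≡ J′ × I ≡ I′
  diff-injective {J′ = J′} (t<I , I≤J , _) (t<I′ , I′≤J′ , _) U≡ V≡ =
    let I≡I′ = ∸-cancelʳ-≡ t<I t<I′ U≡ in
    ∸-cancelʳ-≡ I≤J (subst (_≤ J′) (sym I≡I′) I′≤J′) (trans V≡ (cong (J′ ∸_) (sym I≡I′))) , I≡I′

  diff-surjective : ∀ {n} U t V → U + t + V + 2 ≤ n →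
                    ∃[ J ] ∃[ I ] ChainIndex n J I t × I ∸ suc t ≡ U × J ∸ I ≡ V
  diff-surjective {n} U t V in-triangle =
    J , I , (s≤s (m≤m+n t U) , m≤m+n I V , J<n) , m+n∸m≡n (suc t) U , m+n∸m≡n I V
    where
    I = suc t + U
    J = I + V
    J<n : J < n
    J<n = subst (_≤ n) (diff-coordinate-sum U t V) in-triangle

module Triangle where

  open import Defs using (r; g; y; b; o; s)
  open ChainIndices
  open import Data.Nat using (ℕ; suc; _+_; _∸_; _≤_; _<_)
  open import Data.Nat.Tactic.RingSolver using (solve-∀)
  open import Data.Nat.Properties using (suc-injective; +-identityʳ; +-comm)
  open import Data.Integer as ℤ using (ℤ; +_; -[1+_])
  import Data.Integer.Properties as ℤ
  open import Data.Product using (_×_; _,_; proj₁; proj₂; ∃-syntax)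
  open import Relation.Binary.PropositionalEquality hiding (J)
  open import Function using (_∘_)

  Point : Set
  Point = ℕ × ℕ × ℕ

  InTriangle : ℕ → Point → Set
  InTriangle n (a , c , d) = a + c + d + 2 ≤ n

  data Shift : Set where
    keep up down : Shift

  Shifted : Shift → ℕ → ℕ → Set
  Shifted keep a a′ = a′ ≡ a
  Shifted up   a a′ = a′ ≡ suc a
  Shifted down a a′ = a ≡ suc a′

  Shifted-functional : ∀ σ {a a′ a″} → Shifted σ a a′ → Shifted σ a a″ → a′ ≡ a″
  Shifted-functional keep eq eq′ = trans eq (sym eq′)
  Shifted-functional up   eq eq′ = trans eq (sym eq′)
  Shifted-functional down eq eq′ = suc-injective (trans (sym eq) eq′)

  shifts : Color → Shift × Shift × Shift
  shifts r = up   , keep , keep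
  shifts g = keep , up   , keep
  shifts y = keep , keep , up
  shifts b = down , up   , keep
  shifts o = down , keep , up
  shifts s = keep , up   , down

  -- v = u + vec x, coordinatewise over ℕ (see Moves⇒ℤ and ℤ⇒Moves).
  Moves : Color → Point → Point → Set
  Moves x (a , c , d) (a′ , c′ , d′) =
    let σ₁ , σ₂ , σ₃ = shifts x in Shifted σ₁ a a′ × Shifted σ₂ c c′ × Shifted σ₃ d d′

  Moves-functional : ∀ x {u v w} → Moves x u v → Moves x u w → v ≡ w
  Moves-functional x (eq₁ , eq₂ , eq₃) (eq₁′ , eq₂′ , eq₃′) =
    cong₂ _,_ (Shifted-functional _ eq₁ eq₁′)
              (cong₂ _,_ (Shifted-functional _ eq₂ eq₂′) (Shifted-functional _ eq₃ eq₃′))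

  -- The covers of T_n({x}); that the source lies in T_n is ensured by the lists Step is used on.
  Step : Color → ℕ → Point → Point → Set
  Step x n u v = Moves x u v × InTriangle n v

  toℤ³ : Point → Vec3
  toℤ³ (a , c , d) = (+ a , + c , + d)

  shiftℤ : Shift → ℤ
  shiftℤ keep = + 0
  shiftℤ up   = + 1
  shiftℤ down = -[1+ 0 ]

  vec≡shifts : ∀ x → let σ₁ , σ₂ , σ₃ = shifts x in vec x ≡ (shiftℤ σ₁ , shiftℤ σ₂ , shiftℤ σ₃)
  vec≡shifts r = refl
  vec≡shifts g = refl
  vec≡shifts y = refl
  vec≡shifts b = refl
  vec≡shifts o = refl
  vec≡shifts s = refl

  Shifted⇒ℤ : ∀ σ {a a′} → Shifted σ a a′ → + a′ ≡ + a ℤ.+ shiftℤ σ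
  Shifted⇒ℤ keep {a} refl = cong +_ (sym (+-identityʳ a))
  Shifted⇒ℤ up   {a} refl = cong +_ (+-comm 1 a)
  Shifted⇒ℤ down      refl = refl

  ℤ⇒Shifted : ∀ σ a a′ → + a′ ≡ + a ℤ.+ shiftℤ σ → Shifted σ a a′
  ℤ⇒Shifted keep a       a′ eq = trans (ℤ.+-injective eq) (+-identityʳ a)
  ℤ⇒Shifted up   a       a′ eq = trans (ℤ.+-injective eq) (+-comm a 1)
  ℤ⇒Shifted down (suc a) a′ eq = cong suc (sym (ℤ.+-injective eq))

  Moves⇒ℤ : ∀ x u v → Moves x u v → toℤ³ v ≡ toℤ³ u +³ vec x
  Moves⇒ℤ x (a , c , d) (a′ , c′ , d′) (eq₁ , eq₂ , eq₃) rewrite vec≡shifts x =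
    cong₂ _,_ (Shifted⇒ℤ _ eq₁) (cong₂ _,_ (Shifted⇒ℤ _ eq₂) (Shifted⇒ℤ _ eq₃))

  ℤ⇒Moves : ∀ x u v → toℤ³ v ≡ toℤ³ u +³ vec x → Moves x u v
  ℤ⇒Moves x (a , c , d) (a′ , c′ , d′) eq rewrite vec≡shifts x =
    ℤ⇒Shifted _ a a′ (cong proj₁ eq) ,
    ℤ⇒Shifted _ c c′ (cong (proj₁ ∘ proj₂) eq) ,
    ℤ⇒Shifted _ d d′ (cong (proj₂ ∘ proj₂) eq)

  -- T_n({x}) as the disjoint union, over 0 ≤ I ≤ J < n, of the I-element chains
  -- point n J I 0 ⋖ ⋯ ⋖ point n J I (I ∸ 1); rank is the coordinate that x increases.
  record ChainCover (x : Color) : Set where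
    field
      point            : ℕ → ℕ → ℕ → ℕ → Point
      rank             : Point → ℕ
      rank-step        : ∀ {u v} → Moves x u v → rank v ≡ suc (rank u)
      point-step       : ∀ n J I t → suc t < I → Moves x (point n J I t) (point n J I (suc t))
      step-from-top    : ∀ n J I t v → ChainIndex n J I t → Moves x (point n J I t) v → InTriangle n v → suc t < I
      point-∈          : ∀ n J I t → ChainIndex n J I t → InTriangle n (point n J I t)
      point-injective  : ∀ n J I t J′ I′ t′ → ChainIndex n J I t → ChainIndex n J′ I′ t′ →
                         point n J I t ≡ point n J′ I′ t′ → J ≡ J′ × I ≡ I′ × t ≡ t′
      point-surjective : ∀ n p → InTriangle n p → ∃[ J ] ∃[ I ] ∃[ t ] ChainIndex n J I t × point n J I t ≡ p

  resum : ∀ {n m m′} → m ≡ m′ → m + 2 ≤ n → m′ + 2 ≤ n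
  resum {n} = subst (λ m → m + 2 ≤ n)

  swap₂₃ : ∀ a c d → a + c + d ≡ a + d + c
  swap₂₃ = solve-∀

  rotate : ∀ a c d → a + c + d ≡ d + a + c
  rotate = solve-∀

  swap₁₃ : ∀ a c d → a + c + d ≡ d + c + a
  swap₁₃ = solve-∀

  first second third : Point → ℕ
  first  (a , _ , _) = a
  second (_ , c , _) = c
  third  (_ , _ , d) = d

  chainCover-y : ChainCover y
  chainCover-y = record
    { point = λ n J I t → (J ∸ I , n ∸ suc J , t) ; rank = third ; rank-step = proj₂ ∘ proj₂
    ; point-step = λ _ _ _ _ _ → refl , refl , refl
    ; step-from-top = λ { n J I t _ ix (refl , refl , refl) in-T → axis-top ix in-T }
    ; point-∈ = λ _ _ _ _ → axis-∈
    ; point-injective = λ _ _ _ _ _ _ _ ix ix′ eq →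
        let J≡ , I≡ = axis-injective ix ix′ (cong first eq) (cong second eq) in J≡ , I≡ , cong third eq
    ; point-surjective = λ { n (a , c , d) in-T →
        let J , I , ix , a≡ , c≡ = axis-surjective a c d in-T in J , I , d , ix , cong₂ _,_ a≡ (cong (_, d) c≡) } }

  chainCover-g : ChainCover g
  chainCover-g = record
    { point = λ n J I t → (J ∸ I , t , n ∸ suc J) ; rank = second ; rank-step = proj₁ ∘ proj₂
    ; point-step = λ _ _ _ _ _ → refl , refl , refl
    ; step-from-top = λ { n J I t _ ix (refl , refl , refl) in-T →
        axis-top ix (resum (swap₂₃ (J ∸ I) (suc t) (n ∸ suc J)) in-T) }
    ; point-∈ = λ n J I t ix → resum (swap₂₃ (J ∸ I) (n ∸ suc J) t) (axis-∈ ix)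
    ; point-injective = λ _ _ _ _ _ _ _ ix ix′ eq →
        let J≡ , I≡ = axis-injective ix ix′ (cong first eq) (cong third eq) in J≡ , I≡ , cong second eq
    ; point-surjective = λ { n (a , c , d) in-T →
        let J , I , ix , a≡ , d≡ = axis-surjective a d c (resum (swap₂₃ a c d) in-T)
        in J , I , c , ix , cong₂ _,_ a≡ (cong (c ,_) d≡) } }

  chainCover-r : ChainCover r
  chainCover-r = record
    { point = λ n J I t → (t , J ∸ I , n ∸ suc J) ; rank = first ; rank-step = proj₁
    ; point-step = λ _ _ _ _ _ → refl , refl , refl
    ; step-from-top = λ { n J I t _ ix (refl , refl , refl) in-T →
        axis-top ix (resum (sym (rotate (J ∸ I) (n ∸ suc J) (suc t))) in-T) }
    ; point-∈ = λ n J I t ix → resum (rotate (J ∸ I) (n ∸ suc J) t) (axis-∈ ix)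
    ; point-injective = λ _ _ _ _ _ _ _ ix ix′ eq →
        let J≡ , I≡ = axis-injective ix ix′ (cong second eq) (cong third eq) in J≡ , I≡ , cong first eq
    ; point-surjective = λ { n (a , c , d) in-T →
        let J , I , ix , c≡ , d≡ = axis-surjective c d a (resum (sym (rotate c d a)) in-T)
        in J , I , a , ix , cong (a ,_) (cong₂ _,_ c≡ d≡) } }

  chainCover-b : ChainCover b
  chainCover-b = record
    { point = λ n J I t → (I ∸ suc t , t , J ∸ I) ; rank = second ; rank-step = proj₁ ∘ proj₂
    ; point-step = λ _ _ _ _ t<I → diff-step t<I , refl , refl
    ; step-from-top = λ { n J I t _ ix (eq , _ , _) in-T → diff-top I t eq }
    ; point-∈ = λ _ _ _ _ → diff-∈
    ; point-injective = λ { _ _ _ t _ _ _ ix ix′ eq → injective ix ix′ eq }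
    ; point-surjective = λ { n (a , c , d) in-T →
        let J , I , ix , a≡ , d≡ = diff-surjective a c d in-T in J , I , c , ix , cong₂ _,_ a≡ (cong (c ,_) d≡) } }
    where
    injective : ∀ {n J I t J′ I′ t′} → ChainIndex n J I t → ChainIndex n J′ I′ t′ →
                (I ∸ suc t , t , J ∸ I) ≡ (I′ ∸ suc t′ , t′ , J′ ∸ I′) → J ≡ J′ × I ≡ I′ × t ≡ t′
    injective ix ix′ eq with refl ← cong second eq =
      let J≡ , I≡ = diff-injective ix ix′ (cong first eq) (cong third eq) in J≡ , I≡ , refl

  chainCover-o : ChainCover o
  chainCover-o = record
    { point = λ n J I t → (I ∸ suc t , J ∸ I , t) ; rank = third ; rank-step = proj₂ ∘ proj₂
    ; point-step = λ _ _ _ _ t<I → diff-step t<I , refl , refl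
    ; step-from-top = λ { n J I t _ ix (eq , _ , _) in-T → diff-top I t eq }
    ; point-∈ = λ n J I t ix → resum (swap₂₃ (I ∸ suc t) t (J ∸ I)) (diff-∈ ix)
    ; point-injective = λ { _ _ _ t _ _ _ ix ix′ eq → injective ix ix′ eq }
    ; point-surjective = λ { n (a , c , d) in-T →
        let J , I , ix , a≡ , c≡ = diff-surjective a d c (resum (swap₂₃ a c d) in-T)
        in J , I , d , ix , cong₂ _,_ a≡ (cong (_, d) c≡) } }
    where
    injective : ∀ {n J I t J′ I′ t′} → ChainIndex n J I t → ChainIndex n J′ I′ t′ →
                (I ∸ suc t , J ∸ I , t) ≡ (I′ ∸ suc t′ , J′ ∸ I′ , t′) → J ≡ J′ × I ≡ I′ × t ≡ t′
    injective ix ix′ eq with refl ← cong third eq =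
      let J≡ , I≡ = diff-injective ix ix′ (cong first eq) (cong second eq) in J≡ , I≡ , refl

  chainCover-s : ChainCover s
  chainCover-s = record
    { point = λ n J I t → (J ∸ I , t , I ∸ suc t) ; rank = second ; rank-step = proj₁ ∘ proj₂
    ; point-step = λ _ _ _ _ t<I → refl , refl , diff-step t<I
    ; step-from-top = λ { n J I t _ ix (_ , _ , eq) in-T → diff-top I t eq }
    ; point-∈ = λ n J I t ix → resum (swap₁₃ (I ∸ suc t) t (J ∸ I)) (diff-∈ ix)
    ; point-injective = λ { _ _ _ t _ _ _ ix ix′ eq → injective ix ix′ eq }
    ; point-surjective = λ { n (a , c , d) in-T →
        let J , I , ix , d≡ , a≡ = diff-surjective d c a (resum (swap₁₃ a c d) in-T)
        in J , I , c , ix , cong₂ _,_ a≡ (cong (c ,_) d≡) } }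
    where
    injective : ∀ {n J I t J′ I′ t′} → ChainIndex n J I t → ChainIndex n J′ I′ t′ →
                (J ∸ I , t , I ∸ suc t) ≡ (J′ ∸ I′ , t′ , I′ ∸ suc t′) → J ≡ J′ × I ≡ I′ × t ≡ t′
    injective ix ix′ eq with refl ← cong second eq =
      let J≡ , I≡ = diff-injective ix ix′ (cong third eq) (cong first eq) in J≡ , I≡ , refl

  chainCover : ∀ x → ChainCover x
  chainCover r = chainCover-r
  chainCover g = chainCover-g
  chainCover y = chainCover-y
  chainCover b = chainCover-b
  chainCover o = chainCover-o
  chainCover s = chainCover-s

module TriangleList where

  open Triangle using (InTriangle)
  open ListFacts using (∈-concatMap⁺′; ∈-concatMap⁻′; Unique-concatMap⁺)
  open import Data.Nat using (_+_; _≤_; _<_; s≤s; z≤n)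
  open import Data.Nat.Properties using (≤-trans; ≤-<-trans; m≤m+n; m≤n+m; +-comm; +-monoʳ-≤)
  open import Data.Product using (_,_; proj₁; proj₂)
  open import Data.List using (upTo)
  open import Data.List.Relation.Unary.Unique.Propositional using (Unique)
  import Data.List.Relation.Unary.Unique.Propositional.Properties as Unique
  open import Data.List.Membership.Propositional using (_∈_)
  open import Data.List.Membership.Propositional.Properties using (∈-filter⁺; ∈-filter⁻; ∈-map⁺; ∈-map⁻; ∈-upTo⁺)
  open import Relation.Binary.PropositionalEquality using (subst; cong; trans; sym)
  open import Function using (_∘_)

  ∈-Tlist⁻ : ∀ n {p} → p ∈ Tlist n → InTriangle n p
  ∈-Tlist⁻ n {a , c , d} p∈ = proj₂ (∈-filter⁻ _ {xs = triples n} p∈)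

  ∈-Tlist⁺ : ∀ n p → InTriangle n p → p ∈ Tlist n
  ∈-Tlist⁺ n (a , c , d) in-T =
    ∈-filter⁺ _ {xs = triples n}
      (∈-concatMap⁺′ _ (∈-upTo⁺ a<n) (∈-concatMap⁺′ _ (∈-upTo⁺ c<n) (∈-map⁺ _ (∈-upTo⁺ d<n)))) in-T
    where
    sum<n : a + c + d < n
    sum<n = ≤-trans (subst (_≤ a + c + d + 2) (+-comm (a + c + d) 1) (+-monoʳ-≤ (a + c + d) (s≤s z≤n))) in-T
    a<n : a < n
    a<n = ≤-<-trans (≤-trans (m≤m+n a c) (m≤m+n (a + c) d)) sum<n
    c<n : c < n
    c<n = ≤-<-trans (≤-trans (m≤n+m c a) (m≤m+n (a + c) d)) sum<n
    d<n : d < n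
    d<n = ≤-<-trans (m≤n+m d (a + c)) sum<n

  Unique-Tlist : ∀ n → Unique (Tlist n)
  Unique-Tlist n = Unique.filter⁺ _ {xs = triples n}
    (Unique-concatMap⁺ _ (upTo n) (Unique.upTo⁺ n)
      (λ a _ → Unique-concatMap⁺ _ (upTo n) (Unique.upTo⁺ n)
        (λ c _ → Unique.map⁺ (cong (proj₂ ∘ proj₂)) (Unique.upTo⁺ n))
        (λ c c′ _ _ _ p∈ p∈′ → let _ , _ , eq = ∈-map⁻ _ p∈ ; _ , _ , eq′ = ∈-map⁻ _ p∈′ in
                                trans (cong (proj₁ ∘ proj₂) (sym eq)) (cong (proj₁ ∘ proj₂) eq′)))
      (λ a a′ _ _ _ p∈ p∈′ →
        let c , _ , p∈c = ∈-concatMap⁻′ _ (upTo n) p∈ ; c′ , _ , p∈c′ = ∈-concatMap⁻′ _ (upTo n) p∈′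
            _ , _ , eq = ∈-map⁻ _ p∈c ; _ , _ , eq′ = ∈-map⁻ _ p∈c′
        in trans (cong proj₁ (sym eq)) (cong proj₁ eq′)))

module SingleColor (x : Color) (n : ℕ) where

  open Polynomial using (≈P-reflexive)
  open ListFacts using (∈-concatMap⁺′; ∈-concatMap⁻′; Unique-concatMap⁺; Unique-⊆-⊇⇒↭; lookup-injective)
  open Counting using (CountIs-⇔)
  open ChainIndices using (ChainIndex)
  open Triangle
  open TriangleList
  open ChainCover (chainCover x)
  open Labellings
  open DownSets (Step x n)
  open import Data.Nat using (ℕ; suc; _<_; s≤s)
  open import Data.Nat.Properties using (≤-pred; <-irrefl; <-trans)
  open import Data.Product using (_×_; _,_; proj₁; proj₂; ∃-syntax)
  open import Data.List using (List; [_]; concatMap; upTo; applyUpTo; lookup)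
  open import Data.List.Properties using (map-∘)
  open import Data.List.Relation.Unary.Any using (here; index)
  open import Data.List.Relation.Unary.Any.Properties using (lookup-index)
  open import Data.List.Relation.Unary.Unique.Propositional using (Unique)
  import Data.List.Relation.Unary.Unique.Propositional.Properties as Unique
  open import Data.List.Membership.Propositional using (_∈_)
  open import Data.List.Membership.Propositional.Properties
    using (∈-lookup; ∈-upTo⁺; ∈-upTo⁻; ∈-applyUpTo⁺; ∈-applyUpTo⁻)
  open import Data.Fin.Subset using () renaming (_∈_ to _∈ₛ_)
  open import Relation.Binary.Construct.Closure.ReflexiveTransitive using (ε; _◅_)
  open import Relation.Binary.PropositionalEquality hiding (J; [_])
  open import Function using (_∘_)
  open Chain rank (rank-step ∘ proj₁)

  chain : ℕ → ℕ → List Point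
  chain J I = applyUpTo (point n J I) I

  chainsAt : ℕ → List Point
  chainsAt J = concatMap (chain J) (upTo (suc J))

  allChains : List Point
  allChains = concatMap chainsAt (upTo n)

  chainIndex : ∀ {J I t} → J ∈ upTo n → I ∈ upTo (suc J) → t < I → ChainIndex n J I t
  chainIndex J∈ I∈ t<I = t<I , ≤-pred (∈-upTo⁻ I∈) , ∈-upTo⁻ J∈

  ∈-chain⁻ : ∀ {J I p} → J ∈ upTo n → I ∈ upTo (suc J) → p ∈ chain J I →
             ∃[ t ] ChainIndex n J I t × p ≡ point n J I t
  ∈-chain⁻ J∈ I∈ p∈ = let t , t<I , p≡ = ∈-applyUpTo⁻ _ p∈ in t , chainIndex J∈ I∈ t<I , p≡

  ∈-allChains⁻ : ∀ {p} → p ∈ allChains → ∃[ J ] ∃[ I ] ∃[ t ] ChainIndex n J I t × p ≡ point n J I t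
  ∈-allChains⁻ p∈ =
    let J , J∈ , p∈J = ∈-concatMap⁻′ chainsAt (upTo n) p∈
        I , I∈ , p∈I = ∈-concatMap⁻′ (chain J) (upTo (suc J)) p∈J
    in J , I , ∈-chain⁻ J∈ I∈ p∈I

  ∈-allChains⁺ : ∀ {J I t} → ChainIndex n J I t → point n J I t ∈ allChains
  ∈-allChains⁺ (t<I , I≤J , J<n) =
    ∈-concatMap⁺′ chainsAt (∈-upTo⁺ J<n) (∈-concatMap⁺′ (chain _) (∈-upTo⁺ (s≤s I≤J)) (∈-applyUpTo⁺ _ t<I))

  allChains⊆Tlist : ∀ {p} → p ∈ allChains → p ∈ Tlist n
  allChains⊆Tlist {p} p∈ =
    let J , I , t , ix , p≡ = ∈-allChains⁻ p∈ in ∈-Tlist⁺ n p (subst (InTriangle n) (sym p≡) (point-∈ n J I t ix))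

  Tlist⊆allChains : ∀ {p} → p ∈ Tlist n → p ∈ allChains
  Tlist⊆allChains {p} p∈ =
    let J , I , t , ix , p≡ = point-surjective n p (∈-Tlist⁻ n p∈) in subst (_∈ allChains) p≡ (∈-allChains⁺ ix)

  Unique-chainsAt : ∀ {J} → J ∈ upTo n → Unique (chainsAt J)
  Unique-chainsAt {J} J∈ = Unique-concatMap⁺ (chain J) (upTo (suc J)) (Unique.upTo⁺ (suc J))
    (λ I I∈ → Unique.applyUpTo⁺₁ _ I (λ {t} {t′} t<t′ t′<I eq →
       <-irrefl (proj₂ (proj₂ (point-injective n J I t J I t′
                  (chainIndex J∈ I∈ (<-trans t<t′ t′<I)) (chainIndex J∈ I∈ t′<I) eq))) t<t′))
    (λ I I′ p I∈ I′∈ p∈ p∈′ →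
       let t , ix , p≡ = ∈-chain⁻ J∈ I∈ p∈ ; t′ , ix′ , p≡′ = ∈-chain⁻ J∈ I′∈ p∈′ in
       proj₁ (proj₂ (point-injective n J I t J I′ t′ ix ix′ (trans (sym p≡) p≡′))))

  Unique-allChains : Unique allChains
  Unique-allChains = Unique-concatMap⁺ chainsAt (upTo n) (Unique.upTo⁺ n) (λ J → Unique-chainsAt)
    (λ J J′ p J∈ J′∈ p∈ p∈′ →
       let I , I∈ , p∈I = ∈-concatMap⁻′ (chain J) (upTo (suc J)) p∈
           I′ , I′∈ , p∈I′ = ∈-concatMap⁻′ (chain J′) (upTo (suc J′)) p∈′
           t , ix , p≡ = ∈-chain⁻ J∈ I∈ p∈I ; t′ , ix′ , p≡′ = ∈-chain⁻ J′∈ I′∈ p∈I′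
       in proj₁ (point-injective n J I t J′ I′ t′ ix ix′ (trans (sym p≡) p≡′)))

  chain-IsChain : ∀ {J I} → J ∈ upTo n → I ∈ upTo (suc J) → IsChain (point n J I) I
  chain-IsChain J∈ I∈ t 1+t<I = point-step n _ _ t 1+t<I , point-∈ n _ _ (suc t) (chainIndex J∈ I∈ 1+t<I)

  Closed-chain : ∀ {J I} → J ∈ upTo n → I ∈ upTo (suc J) → Closed (chain J I)
  Closed-chain {J} {I} J∈ I∈ {v = v} u∈ (moves , v-in-T) =
    let t , ix , u≡ = ∈-chain⁻ J∈ I∈ u∈
        moves′ = subst (λ u → Moves x u v) u≡ moves
        1+t<I = step-from-top n J I t v ix moves′ v-in-T
    in subst (_∈ chain J I) (Moves-functional x (point-step n J I t 1+t<I) moves′) (∈-applyUpTo⁺ _ 1+t<I)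

  HasDownSetGF-chainsAt : ∀ {J} → J ∈ upTo n → HasDownSetGF (chainsAt J) (qfact (suc J))
  HasDownSetGF-chainsAt {J} J∈ =
    HasDownSetGF-resp-≈P (≈P-reflexive (cong prodP (map-∘ {g = qint} {f = suc} (upTo (suc J)))))
      (HasDownSetGF-concatMap (chain J) (qint ∘ suc) (upTo (suc J)) (Unique-chainsAt J∈)
        (λ I → Closed-chain J∈) (λ I I∈ → HasDownSetGF-chain (point n J I) I (chain-IsChain J∈ I∈)))

  HasDownSetGF-Tlist : HasDownSetGF (Tlist n) (prodFact n)
  HasDownSetGF-Tlist =
    HasDownSetGF-↭ (Unique-⊆-⊇⇒↭ Unique-allChains (Unique-Tlist n) allChains⊆Tlist Tlist⊆allChains)
      (HasDownSetGF-resp-≈P (≈P-reflexive (cong prodP (map-∘ {g = qfact} {f = suc} (upTo n))))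
        (HasDownSetGF-concatMap chainsAt (qfact ∘ suc) (upTo n) Unique-allChains
          (λ J J∈ → Closed-concatMap (chain J) (upTo (suc J)) (λ I → Closed-chain J∈))
          (λ J → HasDownSetGF-chainsAt)))

  elt≡toℤ³ : ∀ i → elt n i ≡ toℤ³ (lookup (Tlist n) i)
  elt≡toℤ³ i with lookup (Tlist n) i
  ... | _ = refl

  Cover⇒Step : ∀ i j → Cover n [ x ] i j → Step x n (lookup (Tlist n) i) (lookup (Tlist n) j)
  Cover⇒Step i j (_ , here refl , elt≡) =
    ℤ⇒Moves x _ _ (subst₂ (λ u v → v ≡ u +³ vec x) (elt≡toℤ³ i) (elt≡toℤ³ j) elt≡) ,
    ∈-Tlist⁻ n (∈-lookup j)

  Step⇒Cover : ∀ i j → Step x n (lookup (Tlist n) i) (lookup (Tlist n) j) → Cover n [ x ] i j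
  Step⇒Cover i j (moves , _) =
    x , here refl , subst₂ (λ u v → v ≡ u +³ vec x) (sym (elt≡toℤ³ i)) (sym (elt≡toℤ³ j)) (Moves⇒ℤ x _ _ moves)

  IsDownSet⇒IsOrderIdeal : ∀ ℓ → IsDownSet (Tlist n) ℓ → IsOrderIdeal n [ x ] ℓ
  IsDownSet⇒IsOrderIdeal ℓ down-closed = ideal
    where
    ideal : IsOrderIdeal n [ x ] ℓ
    ideal i .i ε                j∈ℓ = j∈ℓ
    ideal i j  (cover ◅ k≤*j)   j∈ℓ =
      let i′ , i′≡ , i′∈ℓ = Selected⇒∃index (Tlist n) ℓ
            (down-closed (∈-lookup i) (Cover⇒Step i _ cover)
              (index⇒Selected (Tlist n) ℓ _ refl (ideal _ j k≤*j j∈ℓ)))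
      in subst (_∈ₛ ℓ) (lookup-injective (Tlist n) (Unique-Tlist n) i′ i i′≡) i′∈ℓ

  IsOrderIdeal⇒IsDownSet : ∀ ℓ → IsOrderIdeal n [ x ] ℓ → IsDownSet (Tlist n) ℓ
  IsOrderIdeal⇒IsDownSet ℓ ideal u∈ step v-sel =
    let i = index u∈
        i≡ = sym (lookup-index u∈)
        j , j≡ , j∈ℓ = Selected⇒∃index (Tlist n) ℓ v-sel
        cover = Step⇒Cover i j (subst₂ (Step x n) (sym i≡) (sym j≡) step)
    in index⇒Selected (Tlist n) ℓ i i≡ (ideal i j (cover ◅ ε) j∈ℓ)

  idealGenFun : IsIdealGenFun n [ x ] (prodFact n)
  idealGenFun k = CountIs-⇔
    (λ ℓ (down-closed , size) → IsDownSet⇒IsOrderIdeal ℓ down-closed , size)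
    (λ ℓ (ideal , size) → IsOrderIdeal⇒IsDownSet ℓ ideal , size)
    (HasDownSetGF-Tlist k)

theorem2p5 : (n : ℕ) → 1 ≤ n → (x : Color) →
    IsIdealGenFun n [ x ] (prodFact n)
    × ((prodFact n *P denomProd (n ∸ 1)) ≈P numerProd (n ∸ 1))
theorem2p5 (suc m) _ x = SingleColor.idealGenFun x (suc m) , QFactorial.prodFact-*P-denomProd m
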